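{- Let $h$ be a positive integer and let $q$ be the product of all primes $p\le h^2$. Then \[2\sum_{d=1}^{h}\ \sum_{\substack{q_1,q_2,q_3\\ q_i>1,\ q_i\mid q}}\prod_{i=1}^3\frac{\mu(q_i)}{\phi(q_i)}\sum_{\substack{a_1,a_2,a_3\\1\le a_i\le q_i,\ \gcd(a_i,q_i)=1\\ \sum_i a_i/q_i\in\mathbb Z}}e\Big(\sum_{i=1}^3\frac{da_i}{q_i}\Big)=2h\Big(\frac{q}{\phi(q)}\Big)^2-6h\frac{q}{\phi(q)}+4h.\]
   Context: $\mu$ is the Möbius function, $\phi$ Euler's totient, $e(x)=e^{2\pi ix}$. -}

module Defs where

open import Data.Nat as ℕ using (ℕ; zero; suc; _*_; _^_; _∸_)
open import Data.Nat.Divisibility using (_∣?_)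
open import Data.Nat.GCD using (gcd)
open import Data.Nat.Primality using (prime?)
open import Data.Integer as ℤ using (ℤ; +_)
open import Data.Rational as ℚ using (ℚ; _/_)
open import Data.List using (List; []; _∷_; map; filter; length; foldr; concatMap)
open import Data.Nat.ListAction using (product)
open import Data.Bool.ListAction using (any)
open import Data.Bool using (true; false; if_then_else_)
open import Relation.Nullary.Decidable using (⌊_⌋)
open import Relation.Binary.PropositionalEquality using (_≡_)

range : ℕ → ℕ → List ℕ
range a b = go (suc b ∸ a) a
  where
  go : ℕ → ℕ → List ℕ
  go zero    _ = []
  go (suc k) x = x ∷ go k (suc x)

sumℚ : List ℚ → ℚ
sumℚ = foldr ℚ._+_ ℚ.0ℚ

φ : ℕ → ℕ
φ n = length (filter (λ a → gcd a n ℕ.≟ 1) (range 1 n))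

ω : ℕ → ℕ
ω n = length (filter (λ p → prime? p) (filter (λ p → p ∣? n) (range 1 n)))

squarefree : ℕ → Data.Bool.Bool
squarefree n = if any (λ k → ⌊ (k * k) ∣? n ⌋) (range 2 n) then false else true

μ : ℕ → ℤ
μ n = if squarefree n then (ℤ.- ℤ.1ℤ) ℤ.^ ω n else ℤ.0ℤ

-- z / n as a rational; only ever used with n ≥ 1 (the n = 0 clause is a dummy)
frac : ℤ → ℕ → ℚ
frac z zero    = ℚ.0ℚ
frac z (suc n) = z / suc n

primorial : ℕ → ℕ
primorial N = product (filter (λ p → prime? p) (range 1 N))

IsInt : ℚ → Set
IsInt x = ℚ.denominatorℕ x ≡ 1

bigDivisors : ℕ → List ℕ
bigDivisors q = filter (λ d → d ∣? q) (range 2 q)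

units : ℕ → List ℕ
units m = filter (λ a → gcd a m ℕ.≟ 1) (range 1 m)

open import Data.Product using (_×_; _,_)

tripleSum : ℕ → ℕ → ℕ → (ℕ × ℕ × ℕ) → ℚ
tripleSum q₁ q₂ q₃ (a₁ , a₂ , a₃) = frac (+ a₁) q₁ ℚ.+ frac (+ a₂) q₂ ℚ.+ frac (+ a₃) q₃

unitTriples : ℕ → ℕ → ℕ → List (ℕ × ℕ × ℕ)
unitTriples q₁ q₂ q₃ =
  concatMap (λ a₁ → concatMap (λ a₂ → map (λ a₃ → (a₁ , a₂ , a₃)) (units q₃)) (units q₂)) (units q₁)

admissible : ℕ → ℕ → ℕ → List (ℕ × ℕ × ℕ)
admissible q₁ q₂ q₃ = filter (λ t → ℚ.denominatorℕ (tripleSum q₁ q₂ q₃ t) ℕ.≟ 1) (unitTriples q₁ q₂ q₃)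

{-# OPTIONS --safe #-}
-- Since Σ aᵢ/qᵢ ∈ ℤ, every exponential equals 1: the sum over d contributes the factor h and only a
-- weighted count of admissible triples remains. Writing a/r = x/q with x = a·(q/r) turns the pairs
-- (r, a) with 1 < r ∣ q and gcd(a, r) = 1 into the residues 0 < x < q, the weight μ(r)/φ(r) into
-- w(x) = μ(r)/φ(r) for r = q/gcd(x, q), and integrality of the sum into q ∣ x + y + z.
-- Inclusion–exclusion over the zero residues gives T₃ − 3T₂ + 2, where T₃ = Σ w(x)w(y)w(z)[q ∣ x + y + z]
-- and T₂ = Σ w(x)w(y)[q ∣ x + y] run over all residues mod q. For squarefree q the weight is a product
-- of local weights over the primes p ∣ q (1 on multiples of p, −1/(p − 1) elsewhere), so by the Chinese
-- remainder theorem T₂ and T₃ are products of local factors, which are p/(p − 1) and (p/(p − 1))².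
-- Hence T₂ = q/φ(q) and T₃ = (q/φ(q))².

module Submission where

open import Defs
open import Algebra.Bundles using (CommutativeSemigroup)
open import Algebra.Core using (Op₂)
open import Algebra.Structures using (IsCommutativeSemiring; IsCommutativeRing)
open import Data.Bool using (Bool; true; false; T)
open import Data.Bool.ListAction using (any)
open import Data.Empty using (⊥; ⊥-elim)
open import Data.Fin as Fin using (Fin; toℕ; fromℕ<; punchOut)
import Data.Fin.Properties as Fin
import Data.Integer as ℤ
import Data.Integer.Properties as ℤ
import Data.Integer.Solver
open import Data.List using (List; []; _∷_; _++_; map; filter; length; concatMap)
open import Data.List.Membership.Propositional using (_∈_; find; lose)
open import Data.List.Relation.Unary.Any using (here; there)
open import Data.List.Relation.Unary.Any.Properties using (any⁺; any⁻)
open import Data.Nat as ℕ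
  using (ℕ; zero; suc; _+_; _*_; _∸_; _^_; _<_; _≤_; z≤n; s≤s; NonZero; _%_; _/_)
open import Data.Nat.Coprimality as Coprimality using (Coprime; coprime⇒gcd≡1; gcd≡1⇒coprime)
open import Data.Nat.Divisibility
open import Data.Nat.DivMod
open import Data.Nat.GCD
open import Data.Nat.ListAction using (product)
open import Data.Nat.Primality
open import Data.Nat.Properties
import Data.Nat.Solver
open import Data.Product using (∃-syntax; _×_; _,_; proj₁; proj₂)
open import Data.Rational as ℚ using (ℚ)
import Data.Rational.Properties as ℚ
import Data.Rational.Solver
import Data.Rational.Unnormalised as ℚᵘ
import Data.Rational.Unnormalised.Properties as ℚᵘ
open import Data.Sum using (_⊎_; inj₁; inj₂)
open import Function using (_∘_; _⇔_; mk⇔; Equivalence)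
open import Level using (0ℓ)
open import Relation.Binary.PropositionalEquality
open import Relation.Nullary using (Dec; yes; no; ¬_; contradiction)
open import Relation.Nullary.Decidable using (⌊_⌋; toWitness; fromWitness)

-- Residues modulo n

injective⇒surjective : ∀ n (σ : ℕ → ℕ) → (∀ {i} → i < n → σ i < n) →
  (∀ {i j} → i < n → j < n → σ i ≡ σ j → i ≡ j) → ∀ {u} → u < n → ∃[ i ] (i < n × σ i ≡ u)
injective⇒surjective (suc n) σ σ< σ-inj {u} u<n
  with Fin.any? (λ (i : Fin (suc n)) → σ (toℕ i) ℕ.≟ u)
... | yes (i , σi≡u) = toℕ i , Fin.toℕ<n i , σi≡u
... | no σ≢u = contradiction (Fin.injective⇒≤ punched-injective) 1+n≰n
  where
  τ : Fin (suc n) → Fin (suc n)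
  τ i = fromℕ< (σ< (Fin.toℕ<n i))
  toℕ-τ : ∀ i → toℕ (τ i) ≡ σ (toℕ i)
  toℕ-τ i = Fin.toℕ-fromℕ< _
  u≢τ : ∀ i → fromℕ< u<n ≢ τ i
  u≢τ i eq = σ≢u (i , trans (sym (toℕ-τ i)) (trans (cong toℕ (sym eq)) (Fin.toℕ-fromℕ< u<n)))
  punched : Fin (suc n) → Fin n
  punched i = punchOut (u≢τ i)
  punched-injective : ∀ {i j} → punched i ≡ punched j → i ≡ j
  punched-injective {i} {j} eq = Fin.toℕ-injective (σ-inj (Fin.toℕ<n i) (Fin.toℕ<n j)
    (trans (sym (toℕ-τ i)) (trans (cong toℕ (Fin.punchOut-injective (u≢τ i) (u≢τ j) eq)) (toℕ-τ j))))

%-≡⇒∣∸ : ∀ {a b} n .{{_ : NonZero n}} → a % n ≡ b % n → n ∣ b ∸ a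
%-≡⇒∣∸ {a} {b} n eq = divides (b / n ∸ a / n) (begin
  b ∸ a                                    ≡⟨ cong₂ _∸_ (m≡m%n+[m/n]*n b n) (m≡m%n+[m/n]*n a n) ⟩
  (b % n + b / n * n) ∸ (a % n + a / n * n) ≡⟨ cong (λ r → (b % n + b / n * n) ∸ (r + a / n * n)) eq ⟩
  (b % n + b / n * n) ∸ (b % n + a / n * n) ≡⟨ [m+n]∸[m+o]≡n∸o (b % n) _ _ ⟩
  b / n * n ∸ a / n * n                    ≡⟨ *-distribʳ-∸ n (b / n) (a / n) ⟨
  (b / n ∸ a / n) * n                      ∎)
  where open ≡-Reasoning

∣∧<⇒≡0 : ∀ {n m} → n ∣ m → m < n → m ≡ 0
∣∧<⇒≡0 {m = zero}  _   _   = refl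
∣∧<⇒≡0 {m = suc _} n∣m m<n = contradiction (∣⇒≤ n∣m) (<⇒≱ m<n)

module _ (n m : ℕ) .{{_ : NonZero n}} (n⊥m : Coprime n m) where

  private
    ordered : ∀ j {i i′} → i ≤ i′ → i′ < n → (i * m + j) % n ≡ (i′ * m + j) % n → i ≡ i′
    ordered j {i} {i′} i≤i′ i′<n eq =
      ≤-antisym i≤i′ (m∸n≡0⇒m≤n (∣∧<⇒≡0 n∣i′∸i (≤-<-trans (m∸n≤m i′ i) i′<n)))
      where
      difference : (i′ * m + j) ∸ (i * m + j) ≡ m * (i′ ∸ i)
      difference = begin
        (i′ * m + j) ∸ (i * m + j) ≡⟨ cong₂ _∸_ (+-comm (i′ * m) j) (+-comm (i * m) j) ⟩
        (j + i′ * m) ∸ (j + i * m) ≡⟨ [m+n]∸[m+o]≡n∸o j _ _ ⟩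
        i′ * m ∸ i * m             ≡⟨ *-distribʳ-∸ m i′ i ⟨
        (i′ ∸ i) * m               ≡⟨ *-comm (i′ ∸ i) m ⟩
        m * (i′ ∸ i)               ∎
        where open ≡-Reasoning
      n∣i′∸i : n ∣ i′ ∸ i
      n∣i′∸i = Coprimality.coprime-divisor n⊥m (subst (n ∣_) difference (%-≡⇒∣∸ n eq))

  affine-mod-injective : ∀ j {i i′} → i < n → i′ < n →
                         (i * m + j) % n ≡ (i′ * m + j) % n → i ≡ i′
  affine-mod-injective j {i} {i′} i<n i′<n eq with ≤-total i i′
  ... | inj₁ i≤i′ = ordered j i≤i′ i′<n eq
  ... | inj₂ i′≤i = sym (ordered j i′≤i i<n (sym eq))

  affine-mod-surjective : ∀ j {u} → u < n → ∃[ i ] (i < n × (i * m + j) % n ≡ u)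
  affine-mod-surjective j =
    injective⇒surjective n (λ i → (i * m + j) % n) (λ _ → m%n<n _ n) (affine-mod-injective j)

-- Finite sums

Periodic : {A : Set} → ℕ → (ℕ → A) → Set
Periodic n f = ∀ x → f (x + n) ≡ f x

periodic-shift : ∀ {A : Set} {n} {f : ℕ → A} → Periodic n f → ∀ k x → f (x + k * n) ≡ f x
periodic-shift {n = n} {f} f-per zero    x = cong f (+-identityʳ x)
periodic-shift {n = n} {f} f-per (suc k) x = begin
  f (x + (n + k * n)) ≡⟨ cong f (trans (cong (x +_) (+-comm n (k * n))) (sym (+-assoc x (k * n) n))) ⟩
  f (x + k * n + n)   ≡⟨ f-per _ ⟩
  f (x + k * n)       ≡⟨ periodic-shift f-per k x ⟩
  f x                 ∎
  where open ≡-Reasoning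

periodic-% : ∀ {A : Set} {n} .{{_ : NonZero n}} {f : ℕ → A} → Periodic n f → ∀ x → f x ≡ f (x % n)
periodic-% {n = n} {f} f-per x =
  trans (cong f (m≡m%n+[m/n]*n x n)) (periodic-shift f-per (x / n) (x % n))

interval : ℕ → ℕ → List ℕ
interval zero    x = []
interval (suc k) x = x ∷ interval k (suc x)

range≡interval : ∀ a b → range a b ≡ interval (suc b ∸ a) a
range≡interval a b = go (suc b ∸ a) a refl
  where
  go : ∀ k a → suc b ∸ a ≡ k → range a b ≡ interval k a
  go zero    a eq rewrite eq = refl
  go (suc k) a eq = step (go k (suc a) b∸a≡k)
    where
    b∸a≡k : b ∸ a ≡ k
    b∸a≡k = trans (sym (pred[m∸n]≡m∸[1+n] (suc b) a)) (cong ℕ.pred eq)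
    step : range (suc a) b ≡ interval k (suc a) → range a b ≡ interval (suc k) a
    step ih rewrite eq | b∸a≡k = cong (a ∷_) ih

∈-interval⁻ : ∀ {k len x} → k ∈ interval len x → x ≤ k
∈-interval⁻ {len = suc _} (here refl) = ≤-refl
∈-interval⁻ {len = suc _} (there k∈) = <⇒≤ (∈-interval⁻ k∈)

∈-interval⁺ : ∀ {k len x} → x ≤ k → k < x + len → k ∈ interval len x
∈-interval⁺ {len = zero}  {x} x≤k k<x+0 = contradiction (subst (_ <_) (+-identityʳ x) k<x+0) (≤⇒≯ x≤k)
∈-interval⁺ {k} {suc _} {x} x≤k k<x+len with m≤n⇒m<n∨m≡n x≤k
... | inj₁ x<k  = there (∈-interval⁺ x<k (subst (k <_) (+-suc x _) k<x+len))
... | inj₂ refl = here refl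

module FiniteSums {A : Set} {_+_ _*_ : Op₂ A} {0# 1# : A}
                  (isCS : IsCommutativeSemiring _≡_ _+_ _*_ 0# 1#) where

  private
    module R = IsCommutativeSemiring isCS
    sum-commutativeSemigroup : CommutativeSemigroup 0ℓ 0ℓ
    sum-commutativeSemigroup = record { isCommutativeSemigroup = R.+-isCommutativeSemigroup }
  open import Algebra.Properties.CommutativeSemigroup sum-commutativeSemigroup using (interchange)
  open ≡-Reasoning

  private variable
    B C : Set

  when : {P : Set} → Dec P → A → A
  when (yes _) x = x
  when (no _)  _ = 0#

  when-yes : {P : Set} (d : Dec P) {x : A} → P → when d x ≡ x
  when-yes (yes _) _ = refl
  when-yes (no ¬p) p = contradiction p ¬p

  when-no : {P : Set} (d : Dec P) {x : A} → ¬ P → when d x ≡ 0#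
  when-no (yes p) ¬p = contradiction p ¬p
  when-no (no _)  _  = refl

  when-cong : {P : Set} (d : Dec P) {x y : A} → (P → x ≡ y) → when d x ≡ when d y
  when-cong (yes p) x≡y = x≡y p
  when-cong (no _)  _   = refl

  when-0# : {P : Set} (d : Dec P) → when d 0# ≡ 0#
  when-0# (yes _) = refl
  when-0# (no _)  = refl

  when-⇔ : {P Q : Set} (p : Dec P) (q : Dec Q) {x : A} → (P → Q) → (Q → P) → when p x ≡ when q x
  when-⇔ (yes _) (yes _) _   _   = refl
  when-⇔ (no _)  (no _)  _   _   = refl
  when-⇔ (yes p) (no ¬q) p⇒q _   = contradiction (p⇒q p) ¬q
  when-⇔ (no ¬p) (yes q) _   q⇒p = contradiction (q⇒p q) ¬p

  ∑∈ : List B → (B → A) → A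
  ∑∈ []       f = 0#
  ∑∈ (x ∷ xs) f = f x + ∑∈ xs f

  syntax ∑∈ xs (λ x → e) = ∑[ x ∈ xs ] e

  ∑< : ℕ → (ℕ → A) → A
  ∑< zero    f = 0#
  ∑< (suc n) f = f 0 + ∑< n (λ i → f (suc i))

  syntax ∑< n (λ i → e) = ∑[ i < n ] e

  ∑∈-cong : (xs : List B) {f g : B → A} → (∀ x → f x ≡ g x) → ∑∈ xs f ≡ ∑∈ xs g
  ∑∈-cong []       f≗g = refl
  ∑∈-cong (x ∷ xs) f≗g = cong₂ _+_ (f≗g x) (∑∈-cong xs f≗g)

  ∑∈-++ : (xs ys : List B) (f : B → A) → ∑∈ (xs ++ ys) f ≡ ∑∈ xs f + ∑∈ ys f
  ∑∈-++ []       ys f = sym (R.+-identityˡ _)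
  ∑∈-++ (x ∷ xs) ys f = trans (cong (f x +_) (∑∈-++ xs ys f)) (sym (R.+-assoc _ _ _))

  ∑∈-map : (g : B → C) (xs : List B) (f : C → A) → ∑∈ (map g xs) f ≡ ∑[ x ∈ xs ] f (g x)
  ∑∈-map g []       f = refl
  ∑∈-map g (x ∷ xs) f = cong (f (g x) +_) (∑∈-map g xs f)

  ∑∈-concatMap : (g : B → List C) (xs : List B) (f : C → A) →
                 ∑∈ (concatMap g xs) f ≡ ∑[ x ∈ xs ] ∑∈ (g x) f
  ∑∈-concatMap g []       f = refl
  ∑∈-concatMap g (x ∷ xs) f =
    trans (∑∈-++ (g x) (concatMap g xs) f) (cong (∑∈ (g x) f +_) (∑∈-concatMap g xs f))

  ∑∈-filter : {P : B → Set} (P? : ∀ x → Dec (P x)) (xs : List B) (f : B → A) →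
              ∑∈ (filter P? xs) f ≡ ∑[ x ∈ xs ] when (P? x) (f x)
  ∑∈-filter P? []       f = refl
  ∑∈-filter P? (x ∷ xs) f with P? x
  ... | yes _ = cong (f x +_) (∑∈-filter P? xs f)
  ... | no _  = trans (∑∈-filter P? xs f) (sym (R.+-identityˡ _))

  ∑∈-0# : (xs : List B) → ∑[ x ∈ xs ] 0# ≡ 0#
  ∑∈-0# []       = refl
  ∑∈-0# (x ∷ xs) = trans (R.+-identityˡ _) (∑∈-0# xs)

  ∑∈-+ : (xs : List B) (f g : B → A) → ∑[ x ∈ xs ] (f x + g x) ≡ ∑∈ xs f + ∑∈ xs g
  ∑∈-+ []       f g = sym (R.+-identityˡ 0#)
  ∑∈-+ (x ∷ xs) f g = trans (cong ((f x + g x) +_) (∑∈-+ xs f g)) (interchange _ _ _ _)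

  ∑∈-*ˡ : (c : A) (xs : List B) (f : B → A) → ∑[ x ∈ xs ] (c * f x) ≡ c * ∑∈ xs f
  ∑∈-*ˡ c []       f = sym (R.zeroʳ c)
  ∑∈-*ˡ c (x ∷ xs) f = trans (cong ((c * f x) +_) (∑∈-*ˡ c xs f)) (sym (R.distribˡ c _ _))

  ∑∈-comm : (xs : List B) (ys : List C) (f : B → C → A) →
            ∑[ x ∈ xs ] ∑[ y ∈ ys ] f x y ≡ ∑[ y ∈ ys ] ∑[ x ∈ xs ] f x y
  ∑∈-comm []       ys f = sym (∑∈-0# ys)
  ∑∈-comm (x ∷ xs) ys f = trans (cong (∑∈ ys (f x) +_) (∑∈-comm xs ys f)) (sym (∑∈-+ ys (f x) _))

  ∑<-cong : ∀ n {f g : ℕ → A} → (∀ i → i < n → f i ≡ g i) → ∑< n f ≡ ∑< n g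
  ∑<-cong zero    f≗g = refl
  ∑<-cong (suc n) f≗g = cong₂ _+_ (f≗g 0 (s≤s z≤n)) (∑<-cong n (λ i i<n → f≗g (suc i) (s≤s i<n)))

  ∑<-0# : ∀ n → ∑[ i < n ] 0# ≡ 0#
  ∑<-0# zero    = refl
  ∑<-0# (suc n) = trans (R.+-identityˡ _) (∑<-0# n)

  ∑<-vanishing : ∀ n (f : ℕ → A) → (∀ i → i < n → f i ≡ 0#) → ∑< n f ≡ 0#
  ∑<-vanishing n f f≗0 = trans (∑<-cong n f≗0) (∑<-0# n)

  ∑<-+ : ∀ n (f g : ℕ → A) → ∑[ i < n ] (f i + g i) ≡ ∑< n f + ∑< n g
  ∑<-+ zero    f g = sym (R.+-identityˡ 0#)
  ∑<-+ (suc n) f g = trans (cong ((f 0 + g 0) +_) (∑<-+ n _ _)) (interchange _ _ _ _)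

  ∑<-*ˡ : ∀ c n (f : ℕ → A) → ∑[ i < n ] (c * f i) ≡ c * ∑< n f
  ∑<-*ˡ c zero    f = sym (R.zeroʳ c)
  ∑<-*ˡ c (suc n) f = trans (cong ((c * f 0) +_) (∑<-*ˡ c n _)) (sym (R.distribˡ c _ _))

  ∑<-*ʳ : ∀ c n (f : ℕ → A) → ∑[ i < n ] (f i * c) ≡ ∑< n f * c
  ∑<-*ʳ c n f = trans (∑<-cong n (λ i _ → R.*-comm (f i) c)) (trans (∑<-*ˡ c n f) (R.*-comm c _))

  ∑<-comm : ∀ n m (f : ℕ → ℕ → A) → ∑[ i < n ] ∑[ j < m ] f i j ≡ ∑[ j < m ] ∑[ i < n ] f i j
  ∑<-comm zero    m f = sym (∑<-0# m)
  ∑<-comm (suc n) m f =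
    trans (cong (∑< m (f 0) +_) (∑<-comm n m (λ i → f (suc i)))) (sym (∑<-+ m (f 0) _))

  ∑<-when : ∀ {P : Set} (d : Dec P) n (f : ℕ → A) → when d (∑< n f) ≡ ∑[ i < n ] when d (f i)
  ∑<-when (yes _) n f = refl
  ∑<-when (no _)  n f = sym (∑<-0# n)

  ∑<-+-split : ∀ a b (f : ℕ → A) → ∑< (a ℕ.+ b) f ≡ ∑< a f + (∑[ j < b ] f (a ℕ.+ j))
  ∑<-+-split zero    b f = sym (R.+-identityˡ _)
  ∑<-+-split (suc a) b f =
    trans (cong (f 0 +_) (∑<-+-split a b (λ i → f (suc i)))) (sym (R.+-assoc _ _ _))

  ∑<-*-split : ∀ k m (f : ℕ → A) → ∑< (k ℕ.* m) f ≡ ∑[ i < k ] ∑[ j < m ] f (i ℕ.* m ℕ.+ j)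
  ∑<-*-split zero    m f = refl
  ∑<-*-split (suc k) m f = trans (∑<-+-split m (k ℕ.* m) f)
    (cong (∑< m f +_) (trans (∑<-*-split k m (λ x → f (m ℕ.+ x)))
      (∑<-cong k (λ i _ → ∑<-cong m (λ j _ → cong f (sym (+-assoc m (i ℕ.* m) j)))))))

  ∑<-extend : ∀ {n N} (f : ℕ → A) → n ≤ N → (∀ i → n ≤ i → i < N → f i ≡ 0#) → ∑< N f ≡ ∑< n f
  ∑<-extend {n} {N} f n≤N f≗0 = begin
    ∑< N f                                    ≡⟨ cong (λ t → ∑< t f) (sym (m+[n∸m]≡n n≤N)) ⟩
    ∑< (n ℕ.+ (N ∸ n)) f                      ≡⟨ ∑<-+-split n (N ∸ n) f ⟩
    ∑< n f + (∑[ j < N ∸ n ] f (n ℕ.+ j))      ≡⟨ cong (∑< n f +_) (∑<-vanishing (N ∸ n) _ tail≗0) ⟩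
    ∑< n f + 0#                               ≡⟨ R.+-identityʳ _ ⟩
    ∑< n f                                    ∎
    where
    tail≗0 : ∀ j → j < N ∸ n → f (n ℕ.+ j) ≡ 0#
    tail≗0 j j<N∸n = f≗0 (n ℕ.+ j) (m≤m+n n j) (subst (n ℕ.+ j <_) (m+[n∸m]≡n n≤N) (+-monoʳ-< n j<N∸n))

  ∑<-rotate : ∀ n (f : ℕ → A) → f n ≡ f 0 → ∑[ i < n ] f (suc i) ≡ ∑< n f
  ∑<-rotate zero    f _     = refl
  ∑<-rotate (suc k) f fn≡f0 = begin
    ∑[ i < suc k ] f (suc i)
      ≡⟨ cong (λ t → ∑[ i < t ] f (suc i)) (+-comm 1 k) ⟩
    ∑[ i < k ℕ.+ 1 ] f (suc i)
      ≡⟨ ∑<-+-split k 1 (λ i → f (suc i)) ⟩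
    (∑[ i < k ] f (suc i)) + (f (suc (k ℕ.+ 0)) + 0#)
      ≡⟨ cong ((∑[ i < k ] f (suc i)) +_) last≡f0 ⟩
    (∑[ i < k ] f (suc i)) + f 0
      ≡⟨ R.+-comm _ _ ⟩
    f 0 + (∑[ i < k ] f (suc i))
      ∎
    where
    last≡f0 : f (suc (k ℕ.+ 0)) + 0# ≡ f 0
    last≡f0 = trans (R.+-identityʳ _) (trans (cong (f ∘ suc) (+-identityʳ k)) fn≡f0)

  ∑<-single : ∀ n (f : ℕ → A) {i₀} → i₀ < n → (∀ i → i < n → i ≢ i₀ → f i ≡ 0#) → ∑< n f ≡ f i₀
  ∑<-single (suc n) f {zero} _ others = begin
    f 0 + (∑[ i < n ] f (suc i)) ≡⟨ cong (f 0 +_) (∑<-vanishing n _ (λ i i<n → others (suc i) (s≤s i<n) λ ())) ⟩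
    f 0 + 0#                     ≡⟨ R.+-identityʳ _ ⟩
    f 0                          ∎
  ∑<-single (suc n) f {suc i₀} (s≤s i₀<n) others = begin
    f 0 + (∑[ i < n ] f (suc i)) ≡⟨ cong (_+ (∑[ i < n ] f (suc i))) (others 0 (s≤s z≤n) λ ()) ⟩
    0# + (∑[ i < n ] f (suc i))  ≡⟨ R.+-identityˡ _ ⟩
    ∑[ i < n ] f (suc i)         ≡⟨ ∑<-single n (λ i → f (suc i)) i₀<n
                                     (λ i i<n i≢i₀ → others (suc i) (s≤s i<n) (i≢i₀ ∘ suc-injective)) ⟩
    f (suc i₀)                   ∎

  ∑<-single² : ∀ N (M : ℕ → ℕ) (f : ℕ → ℕ → A) {i₀ j₀} → i₀ < N → j₀ < M i₀ →
               (∀ i j → i < N → j < M i → i ≢ i₀ → f i j ≡ 0#) →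
               (∀ j → j < M i₀ → j ≢ j₀ → f i₀ j ≡ 0#) →
               ∑[ i < N ] ∑< (M i) (f i) ≡ f i₀ j₀
  ∑<-single² N M f {i₀} i₀<N j₀<M other-rows≗0 other-columns≗0 = trans
    (∑<-single N _ i₀<N (λ i i<N i≢i₀ → ∑<-vanishing (M i) (f i) (λ j j<M → other-rows≗0 i j i<N j<M i≢i₀)))
    (∑<-single (M i₀) (f i₀) j₀<M other-columns≗0)

  ∑∈-interval : ∀ k x (f : ℕ → A) → ∑∈ (interval k x) f ≡ ∑[ i < k ] f (x ℕ.+ i)
  ∑∈-interval zero    x f = refl
  ∑∈-interval (suc k) x f = cong₂ _+_ (cong f (sym (+-identityʳ x)))
    (trans (∑∈-interval k (suc x) f) (∑<-cong k (λ i _ → cong f (sym (+-suc x i)))))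

  ∑<-permute : ∀ n (σ : ℕ → ℕ) (f : ℕ → A) → (∀ {i} → i < n → σ i < n) →
               (∀ {i j} → i < n → j < n → σ i ≡ σ j → i ≡ j) → ∑[ i < n ] f (σ i) ≡ ∑< n f
  ∑<-permute n σ f σ< σ-inj = begin
    ∑[ i < n ] f (σ i)                           ≡⟨ ∑<-cong n (λ i i<n → sym (hits-once i i<n)) ⟩
    ∑[ i < n ] ∑[ u < n ] when (σ i ℕ.≟ u) (f u) ≡⟨ ∑<-comm n n _ ⟩
    ∑[ u < n ] ∑[ i < n ] when (σ i ℕ.≟ u) (f u) ≡⟨ ∑<-cong n (λ u u<n → hit-once u u<n) ⟩
    ∑< n f                                       ∎
    where
    hits-once : ∀ i → i < n → ∑[ u < n ] when (σ i ℕ.≟ u) (f u) ≡ f (σ i)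
    hits-once i i<n = trans
      (∑<-single n _ (σ< i<n) (λ u _ u≢σi → when-no (σ i ℕ.≟ u) (u≢σi ∘ sym)))
      (when-yes (σ i ℕ.≟ σ i) refl)
    hit-once : ∀ u → u < n → ∑[ i < n ] when (σ i ℕ.≟ u) (f u) ≡ f u
    hit-once u u<n with injective⇒surjective n σ σ< σ-inj u<n
    ... | i₀ , i₀<n , σi₀≡u = trans
      (∑<-single n _ i₀<n (λ i i<n i≢i₀ → when-no (σ i ℕ.≟ u)
        (λ σi≡u → i≢i₀ (σ-inj i<n i₀<n (trans σi≡u (sym σi₀≡u))))))
      (when-yes (σ i₀ ℕ.≟ u) σi₀≡u)

  ∑<-periodic-affine : ∀ n m .{{_ : NonZero n}} → Coprime n m → (f : ℕ → A) → Periodic n f →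
                       ∀ j → ∑[ i < n ] f (i ℕ.* m ℕ.+ j) ≡ ∑< n f
  ∑<-periodic-affine n m n⊥m f f-per j = trans
    (∑<-cong n (λ i _ → periodic-% f-per (i ℕ.* m ℕ.+ j)))
    (∑<-permute n (λ i → (i ℕ.* m ℕ.+ j) % n) f (λ _ → m%n<n _ n) (affine-mod-injective n m n⊥m j))

  ∑<-crt : ∀ n m .{{_ : NonZero n}} → Coprime n m → (f g : ℕ → A) → Periodic n f → Periodic m g →
           ∑[ x < n ℕ.* m ] (f x * g x) ≡ ∑< n f * ∑< m g
  ∑<-crt n m n⊥m f g f-per g-per = begin
    ∑[ x < n ℕ.* m ] (f x * g x)
      ≡⟨ ∑<-*-split n m _ ⟩
    ∑[ i < n ] ∑[ j < m ] (f (i ℕ.* m ℕ.+ j) * g (i ℕ.* m ℕ.+ j))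
      ≡⟨ ∑<-cong n (λ i _ → ∑<-cong m λ j _ → cong (f (i ℕ.* m ℕ.+ j) *_) (g-shift i j)) ⟩
    ∑[ i < n ] ∑[ j < m ] (f (i ℕ.* m ℕ.+ j) * g j)
      ≡⟨ ∑<-comm n m _ ⟩
    ∑[ j < m ] ∑[ i < n ] (f (i ℕ.* m ℕ.+ j) * g j)
      ≡⟨ ∑<-cong m (λ j _ → ∑<-*ʳ (g j) n _) ⟩
    ∑[ j < m ] ((∑[ i < n ] f (i ℕ.* m ℕ.+ j)) * g j)
      ≡⟨ ∑<-cong m (λ j _ → cong (_* g j) (∑<-periodic-affine n m n⊥m f f-per j)) ⟩
    ∑[ j < m ] (∑< n f * g j)
      ≡⟨ ∑<-*ˡ (∑< n f) m g ⟩
    ∑< n f * ∑< m g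
      ∎
    where
    g-shift : ∀ i j → g (i ℕ.* m ℕ.+ j) ≡ g j
    g-shift i j = trans (cong g (+-comm (i ℕ.* m) j)) (periodic-shift g-per i j)

  ∑<-crt² : ∀ n m .{{_ : NonZero n}} → Coprime n m → (F G : ℕ → ℕ → A) →
            (∀ y → Periodic n (λ x → F x y)) → (∀ x → Periodic n (F x)) →
            (∀ y → Periodic m (λ x → G x y)) → (∀ x → Periodic m (G x)) →
            ∑[ x < n ℕ.* m ] ∑[ y < n ℕ.* m ] (F x y * G x y)
              ≡ (∑[ x < n ] ∑< n (F x)) * (∑[ x < m ] ∑< m (G x))
  ∑<-crt² n m n⊥m F G Fˣ Fʸ Gˣ Gʸ = trans
    (∑<-cong (n ℕ.* m) (λ x _ → ∑<-crt n m n⊥m (F x) (G x) (Fʸ x) (Gʸ x)))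
    (∑<-crt n m n⊥m _ _ (λ x → ∑<-cong n (λ y _ → Fˣ y x)) (λ x → ∑<-cong m (λ y _ → Gˣ y x)))

  ∑<-crt³ : ∀ n m .{{_ : NonZero n}} → Coprime n m → (F G : ℕ → ℕ → ℕ → A) →
            (∀ y z → Periodic n (λ x → F x y z)) → (∀ x z → Periodic n (λ y → F x y z)) →
            (∀ x y → Periodic n (F x y)) →
            (∀ y z → Periodic m (λ x → G x y z)) → (∀ x z → Periodic m (λ y → G x y z)) →
            (∀ x y → Periodic m (G x y)) →
            ∑[ x < n ℕ.* m ] ∑[ y < n ℕ.* m ] ∑[ z < n ℕ.* m ] (F x y z * G x y z)
              ≡ (∑[ x < n ] ∑[ y < n ] ∑< n (F x y)) * (∑[ x < m ] ∑[ y < m ] ∑< m (G x y))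
  ∑<-crt³ n m n⊥m F G Fˣ Fʸ Fᶻ Gˣ Gʸ Gᶻ = trans
    (∑<-cong (n ℕ.* m) (λ x _ → ∑<-cong (n ℕ.* m) (λ y _ → ∑<-crt n m n⊥m (F x y) (G x y) (Fᶻ x y) (Gᶻ x y))))
    (∑<-crt² n m n⊥m _ _ (λ y x → ∑<-cong n (λ z _ → Fˣ y z x)) (λ x y → ∑<-cong n (λ z _ → Fʸ x z y))
                         (λ y x → ∑<-cong m (λ z _ → Gˣ y z x)) (λ x y → ∑<-cong m (λ z _ → Gʸ x z y)))

-- Arithmetic functions

prime-∤⇒coprime : ∀ {p x} → Prime p → ¬ p ∣ x → Coprime p x
prime-∤⇒coprime pp p∤x (d∣p , d∣x) with prime⇒irreducible pp d∣p
... | inj₁ d≡1 = d≡1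
... | inj₂ refl = contradiction d∣x p∤x

prime≢1 : ∀ {p} → Prime p → p ≢ 1
prime≢1 {suc (suc _)} _ ()

coprime-∣ʳ : ∀ {x m n} → Coprime x n → m ∣ n → Coprime x m
coprime-∣ʳ x⊥n m∣n (d∣x , d∣m) = x⊥n (d∣x , ∣-trans d∣m m∣n)

coprime-*ʳ : ∀ {x m n} → Coprime x m → Coprime x n → Coprime x (m * n)
coprime-*ʳ {x} x⊥m x⊥n (d∣x , d∣mn) =
  x⊥n (d∣x , Coprimality.coprime-divisor (Coprimality.sym (coprime-∣ʳ (Coprimality.sym x⊥m) d∣x)) d∣mn)

coprime-1 : ∀ n → Coprime n 1
coprime-1 n = Coprimality.sym (Coprimality.1-coprimeTo n)

gcd[m+n,n]≡gcd[m,n] : ∀ m n → gcd (m + n) n ≡ gcd m n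
gcd[m+n,n]≡gcd[m,n] m n = ∣-antisym
  (gcd-greatest (∣m+n∣m⇒∣n (subst (gcd (m + n) n ∣_) (+-comm m n) (gcd[m,n]∣m (m + n) n))
                           (gcd[m,n]∣n (m + n) n))
                (gcd[m,n]∣n (m + n) n))
  (gcd-greatest (∣m∣n⇒∣m+n (gcd[m,n]∣m m n) (gcd[m,n]∣n m n)) (gcd[m,n]∣n m n))

gcd[m*o,n*o]≡gcd[m,n]*o : ∀ m n o → gcd (m * o) (n * o) ≡ gcd m n * o
gcd[m*o,n*o]≡gcd[m,n]*o m n o = begin
  gcd (m * o) (n * o) ≡⟨ cong₂ gcd (*-comm m o) (*-comm n o) ⟩
  gcd (o * m) (o * n) ≡⟨ c*gcd[m,n]≡gcd[cm,cn] o m n ⟨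
  o * gcd m n         ≡⟨ *-comm o (gcd m n) ⟩
  gcd m n * o         ∎
  where open ≡-Reasoning

gcd[n,n]≡n : ∀ n → gcd n n ≡ n
gcd[n,n]≡n n = ∣-antisym (gcd[m,n]∣m n n) (gcd-greatest ∣-refl ∣-refl)

gcd[m,p*n]≡gcd[m,n] : ∀ {p m n} → Prime p → ¬ p ∣ m → gcd m (p * n) ≡ gcd m n
gcd[m,p*n]≡gcd[m,n] {p} {m} {n} pp p∤m = ∣-antisym
  (gcd-greatest (gcd[m,n]∣m m (p * n)) (Coprimality.coprime-divisor g⊥p (gcd[m,n]∣n m (p * n))))
  (gcd-greatest (gcd[m,n]∣m m n) (∣-trans (gcd[m,n]∣n m n) (n∣m*n p)))
  where
  g⊥p : Coprime (gcd m (p * n)) p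
  g⊥p = Coprimality.sym (coprime-∣ʳ (prime-∤⇒coprime pp p∤m) (gcd[m,n]∣m m (p * n)))

gcd[m,p*n]≡p*gcd[m,n] : ∀ {p m n} → Coprime p n → p ∣ m → gcd m (p * n) ≡ p * gcd m n
gcd[m,p*n]≡p*gcd[m,n] {p} {m} {n} p⊥n (divides k refl) = begin
  gcd (k * p) (p * n) ≡⟨ cong (λ t → gcd t (p * n)) (*-comm k p) ⟩
  gcd (p * k) (p * n) ≡⟨ c*gcd[m,n]≡gcd[cm,cn] p k n ⟨
  p * gcd k n         ≡⟨ cong (p *_) (∣-antisym
                           (gcd-greatest (∣m⇒∣m*n p (gcd[m,n]∣m k n)) (gcd[m,n]∣n k n))
                           (gcd-greatest g∣k (gcd[m,n]∣n (k * p) n))) ⟩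
  p * gcd (k * p) n   ∎
  where
  open ≡-Reasoning
  g∣k : gcd (k * p) n ∣ k
  g∣k = Coprimality.coprime-divisor (Coprimality.sym (coprime-∣ʳ p⊥n (gcd[m,n]∣n (k * p) n)))
          (subst (gcd (k * p) n ∣_) (*-comm k p) (gcd[m,n]∣m (k * p) n))

coprime-*-∣ : ∀ {m n s} → Coprime m n → m ∣ s → n ∣ s → m * n ∣ s
coprime-*-∣ {m} {n} m⊥n (divides k refl) n∣km = subst (m * n ∣_) (*-comm m k)
  (*-monoʳ-∣ m (Coprimality.coprime-divisor (Coprimality.sym m⊥n) (subst (n ∣_) (*-comm k m) n∣km)))

gcd-nonZero : ∀ m n .{{_ : NonZero n}} → NonZero (gcd m n)
gcd-nonZero m n = ℕ.≢-nonZero (gcd[m,n]≢0 m n (inj₂ (ℕ.≢-nonZero⁻¹ n)))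

module ArithmeticFunctions where

  open FiniteSums +-*-isCommutativeSemiring

  length-filter : ∀ {B : Set} {P : B → Set} (P? : ∀ x → Dec (P x)) xs →
                  length (filter P? xs) ≡ ∑[ x ∈ xs ] when (P? x) 1
  length-filter P? []       = refl
  length-filter P? (x ∷ xs) with P? x
  ... | yes _ = cong suc (length-filter P? xs)
  ... | no _  = length-filter P? xs

  ∑<-1 : ∀ n → ∑[ i < n ] 1 ≡ n
  ∑<-1 zero    = refl
  ∑<-1 (suc n) = cong suc (∑<-1 n)

  coprimality : ℕ → ℕ → ℕ
  coprimality n x = when (gcd x n ℕ.≟ 1) 1

  φ≡∑coprimality[1+i] : ∀ n → φ n ≡ ∑[ i < n ] coprimality n (suc i)
  φ≡∑coprimality[1+i] n = begin
    φ n                                                 ≡⟨ cong (length ∘ filter _) (range≡interval 1 n) ⟩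
    length (filter (λ a → gcd a n ℕ.≟ 1) (interval n 1)) ≡⟨ length-filter _ (interval n 1) ⟩
    ∑∈ (interval n 1) (coprimality n)                    ≡⟨ ∑∈-interval n 1 _ ⟩
    ∑[ i < n ] coprimality n (suc i)                     ∎
    where open ≡-Reasoning

  coprimality-periodic : ∀ n → Periodic n (coprimality n)
  coprimality-periodic n x = cong (λ g → when (g ℕ.≟ 1) 1) (gcd[m+n,n]≡gcd[m,n] x n)

  φ≡∑coprimality : ∀ n → φ n ≡ ∑< n (coprimality n)
  φ≡∑coprimality n = trans (φ≡∑coprimality[1+i] n)
    (∑<-rotate n (coprimality n) (coprimality-periodic n 0))

  coprimality-* : ∀ m n x → coprimality (m * n) x ≡ coprimality m x * coprimality n x
  coprimality-* m n x with gcd x (m * n) ℕ.≟ 1 | gcd x m ℕ.≟ 1 | gcd x n ℕ.≟ 1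
  ... | yes _   | yes _   | yes _   = refl
  ... | yes x⊥mn | no x̸⊥m | _       =
    contradiction (coprime⇒gcd≡1 (coprime-∣ʳ (gcd≡1⇒coprime {x} {m * n} x⊥mn) (m∣m*n n))) x̸⊥m
  ... | yes x⊥mn | yes _  | no x̸⊥n  =
    contradiction (coprime⇒gcd≡1 (coprime-∣ʳ (gcd≡1⇒coprime {x} {m * n} x⊥mn) (n∣m*n m))) x̸⊥n
  ... | no x̸⊥mn | yes x⊥m | yes x⊥n =
    contradiction (coprime⇒gcd≡1 (coprime-*ʳ (gcd≡1⇒coprime {x} {m} x⊥m) (gcd≡1⇒coprime {x} {n} x⊥n))) x̸⊥mn
  ... | no _    | no _    | _       = refl
  ... | no _    | yes _   | no _    = refl

  φ-multiplicative : ∀ m n .{{_ : NonZero m}} → Coprime m n → φ (m * n) ≡ φ m * φ n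
  φ-multiplicative m n m⊥n = begin
    φ (m * n)                                          ≡⟨ φ≡∑coprimality (m * n) ⟩
    ∑< (m * n) (coprimality (m * n))                   ≡⟨ ∑<-cong (m * n) (λ x _ → coprimality-* m n x) ⟩
    ∑[ x < m * n ] (coprimality m x * coprimality n x) ≡⟨ ∑<-crt m n m⊥n _ _ (coprimality-periodic m)
                                                                          (coprimality-periodic n) ⟩
    ∑< m (coprimality m) * ∑< n (coprimality n)        ≡⟨ cong₂ _*_ (φ≡∑coprimality m) (φ≡∑coprimality n) ⟨
    φ m * φ n                                          ∎
    where open ≡-Reasoning

  φ-prime : ∀ {p} → Prime p → φ p ≡ p ∸ 1
  φ-prime {p@(suc t)} pp = begin
    φ p                                           ≡⟨ φ≡∑coprimality p ⟩
    coprimality p 0 + ∑[ i < t ] coprimality p (suc i) ≡⟨ cong₂ _+_ (when-no (gcd 0 p ℕ.≟ 1) (prime≢1 pp))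
                                                     (∑<-cong t (λ i i<t → when-yes (gcd (suc i) p ℕ.≟ 1) (1+i⊥p i<t))) ⟩
    0 + ∑[ i < t ] 1                              ≡⟨ ∑<-1 t ⟩
    t                                             ∎
    where
    open ≡-Reasoning
    1+i⊥p : ∀ {i} → i < t → gcd (suc i) p ≡ 1
    1+i⊥p i<t = trans (gcd-comm (suc i) p) (coprime⇒gcd≡1 (Coprimality.prime⇒coprime pp (s≤s i<t)))
      where i = _

  φ>0 : ∀ n .{{_ : NonZero n}} → 0 < φ n
  φ>0 (suc n) = subst (0 <_) (sym (φ≡∑coprimality[1+i] (suc n)))
    (subst (λ c → 0 < c + ∑[ i < n ] coprimality (suc n) (suc (suc i)))
           (sym (when-yes (gcd 1 (suc n) ℕ.≟ 1) (gcd-zeroˡ (suc n)))) (s≤s z≤n))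

  primeDivisor : ℕ → ℕ → ℕ
  primeDivisor n x = when (x ∣? n) (when (prime? x) 1)

  ω≡∑primeDivisor : ∀ n → ω n ≡ ∑[ i < n ] primeDivisor n (suc i)
  ω≡∑primeDivisor n = begin
    ω n                                                        ≡⟨ length-filter prime? (filter (_∣? n) (range 1 n)) ⟩
    ∑[ x ∈ filter (_∣? n) (range 1 n) ] when (prime? x) 1      ≡⟨ ∑∈-filter (_∣? n) (range 1 n) _ ⟩
    ∑∈ (range 1 n) (primeDivisor n)                            ≡⟨ cong (λ xs → ∑∈ xs (primeDivisor n)) (range≡interval 1 n) ⟩
    ∑∈ (interval n 1) (primeDivisor n)                         ≡⟨ ∑∈-interval n 1 _ ⟩
    ∑[ i < n ] primeDivisor n (suc i)                          ∎
    where open ≡-Reasoning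

  primeDivisor-*-prime : ∀ {p b} x → Prime p → ¬ p ∣ b →
                         primeDivisor (p * b) x ≡ when (x ℕ.≟ p) 1 + primeDivisor b x
  primeDivisor-*-prime {p} {b} x pp p∤b with prime? x
  ... | no ¬px = trans (when-0# (x ∣? (p * b)))
    (sym (cong₂ _+_ (when-no (x ℕ.≟ p) (λ { refl → ¬px pp })) (when-0# (x ∣? b))))
  ... | yes px with x ℕ.≟ p
  ... | yes refl = trans (when-yes (p ∣? (p * b)) (m∣m*n b)) (cong suc (sym (when-no (p ∣? b) p∤b)))
  ... | no x≢p with x ∣? (p * b) | x ∣? b
  ... | yes _    | yes _   = refl
  ... | no _     | no _    = refl
  ... | no x∤pb  | yes x∣b = contradiction (∣n⇒∣m*n p x∣b) x∤pb
  ... | yes x∣pb | no x∤b with euclidsLemma p b px x∣pb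
  ... | inj₂ x∣b = contradiction x∣b x∤b
  ... | inj₁ x∣p with prime⇒irreducible pp x∣p
  ... | inj₁ refl = contradiction refl (prime≢1 px)
  ... | inj₂ x≡p  = contradiction x≡p x≢p

  ω-*-prime : ∀ {p b} .{{_ : NonZero b}} → Prime p → ¬ p ∣ b → ω (p * b) ≡ suc (ω b)
  ω-*-prime {p@(suc t)} {b} pp p∤b = begin
    ω (p * b)                                                  ≡⟨ ω≡∑primeDivisor (p * b) ⟩
    ∑[ i < p * b ] primeDivisor (p * b) (suc i)                ≡⟨ ∑<-cong (p * b) (λ i _ → primeDivisor-*-prime (suc i) pp p∤b) ⟩
    ∑[ i < p * b ] (when (suc i ℕ.≟ p) 1 + primeDivisor b (suc i)) ≡⟨ ∑<-+ (p * b) _ _ ⟩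
    ∑[ i < p * b ] when (suc i ℕ.≟ p) 1 + ∑[ i < p * b ] primeDivisor b (suc i)
                                                               ≡⟨ cong₂ _+_ p-counted-once only-below-b ⟩
    1 + ∑[ i < b ] primeDivisor b (suc i)                      ≡⟨ cong suc (ω≡∑primeDivisor b) ⟨
    suc (ω b)                                                  ∎
    where
    open ≡-Reasoning
    p-counted-once : ∑[ i < p * b ] when (suc i ℕ.≟ p) 1 ≡ 1
    p-counted-once = trans
      (∑<-single (p * b) _ (m≤m*n p b) (λ i _ i≢t → when-no (suc i ℕ.≟ p) (i≢t ∘ suc-injective)))
      (when-yes (p ℕ.≟ p) refl)
    only-below-b : ∑[ i < p * b ] primeDivisor b (suc i) ≡ ∑[ i < b ] primeDivisor b (suc i)
    only-below-b = ∑<-extend _ (m≤n*m b p) (λ i b≤i _ →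
      when-no (suc i ∣? b) (λ 1+i∣b → contradiction (∣⇒≤ 1+i∣b) (<⇒≱ (s≤s b≤i))))

  HasSquareFactor : ℕ → Set
  HasSquareFactor n = ∃[ k ] (2 ≤ k × k * k ∣ n)

  squareTest : ℕ → Bool
  squareTest n = any (λ k → ⌊ (k * k) ∣? n ⌋) (range 2 n)

  squareTest-sound : ∀ n → T (squareTest n) → HasSquareFactor n
  squareTest-sound n test with find (any⁻ _ (range 2 n) test)
  ... | k , k∈range , k²∣n =
    k , ∈-interval⁻ (subst (k ∈_) (range≡interval 2 n) k∈range) , toWitness k²∣n

  squareTest-complete : ∀ n .{{_ : NonZero n}} → HasSquareFactor n → T (squareTest n)
  squareTest-complete n (k@(suc (suc _)) , 2≤k@(s≤s (s≤s z≤n)) , k²∣n) = any⁺ _ (lose k∈range (fromWitness k²∣n))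
    where
    k≤n : k ≤ n
    k≤n = ≤-trans (m≤m*n k k) (∣⇒≤ k²∣n)
    k∈range : k ∈ range 2 n
    k∈range = subst (k ∈_) (sym (range≡interval 2 n))
      (∈-interval⁺ 2≤k (subst (k <_) (sym (m+[n∸m]≡n (≤-trans 2≤k (≤-trans k≤n (n≤1+n n))))) (s≤s k≤n)))

  hasSquareFactor-*-prime : ∀ {p b} → Prime p → ¬ p ∣ b → HasSquareFactor (p * b) → HasSquareFactor b
  hasSquareFactor-*-prime {p} {b} pp p∤b (k , 2≤k , k²∣pb) with p ∣? k
  ... | yes p∣k = contradiction
    (*-cancelˡ-∣ p {{prime⇒nonZero pp}} (∣-trans (*-pres-∣ p∣k p∣k) k²∣pb)) p∤b
  ... | no p∤k = k , 2≤k , Coprimality.coprime-divisor (Coprimality.sym (prime-∤⇒coprime pp p∤k²)) k²∣pb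
    where
    p∤k² : ¬ p ∣ k * k
    p∤k² p∣k² with euclidsLemma k k pp p∣k²
    ... | inj₁ p∣k = p∤k p∣k
    ... | inj₂ p∣k = p∤k p∣k

  squarefree-*-prime : ∀ {p b} .{{_ : NonZero b}} → Prime p → ¬ p ∣ b → squarefree (p * b) ≡ squarefree b
  squarefree-*-prime {p} {b} pp p∤b with squareTest (p * b) in pb-test | squareTest b in b-test
  ... | true  | true  = refl
  ... | false | false = refl
  ... | true  | false = ⊥-elim (subst T b-test
    (squareTest-complete b (hasSquareFactor-*-prime pp p∤b (squareTest-sound (p * b) (subst T (sym pb-test) _)))))
  ... | false | true  = ⊥-elim (subst T pb-test
    (squareTest-complete (p * b) {{m*n≢0 p b {{prime⇒nonZero pp}}}} (lift (squareTest-sound b (subst T (sym b-test) _)))))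
    where
    lift : HasSquareFactor b → HasSquareFactor (p * b)
    lift (k , 2≤k , k²∣b) = k , 2≤k , ∣n⇒∣m*n p k²∣b

  μ-*-prime : ∀ {p b} .{{_ : NonZero b}} → Prime p → ¬ p ∣ b → μ (p * b) ≡ ℤ.-1ℤ ℤ.* μ b
  μ-*-prime {p} {b} pp p∤b rewrite squarefree-*-prime pp p∤b | ω-*-prime pp p∤b with squarefree b
  ... | true  = refl
  ... | false = refl

  φ-*-prime : ∀ {p b} → Prime p → ¬ p ∣ b → φ (p * b) ≡ (p ∸ 1) * φ b
  φ-*-prime {p} {b} pp p∤b = trans (φ-multiplicative p b {{prime⇒nonZero pp}} (prime-∤⇒coprime pp p∤b))
                                   (cong (_* φ b) (φ-prime pp))

-- Rational arithmetic

-- Opened only from here on: with +_ in scope, ℕ sections such as (x +_) are ambiguous.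
open import Data.Integer using (+_)
module ℤSolver = Data.Integer.Solver.+-*-Solver
module ℚSolver = Data.Rational.Solver.+-*-Solver
open FiniteSums (IsCommutativeRing.isCommutativeSemiring ℚ.+-*-isCommutativeRing)

fromℚᵘ-homo-* : ∀ x y → ℚ.fromℚᵘ x ℚ.* ℚ.fromℚᵘ y ≡ ℚ.fromℚᵘ (x ℚᵘ.* y)
fromℚᵘ-homo-* x y = trans (sym (ℚ.fromℚᵘ-toℚᵘ _)) (ℚ.fromℚᵘ-cong (ℚᵘ.≃-trans
  (ℚ.toℚᵘ-homo-* (ℚ.fromℚᵘ x) (ℚ.fromℚᵘ y)) (ℚᵘ.*-cong (ℚ.toℚᵘ-fromℚᵘ x) (ℚ.toℚᵘ-fromℚᵘ y))))

fromℚᵘ-homo-+ : ∀ x y → ℚ.fromℚᵘ x ℚ.+ ℚ.fromℚᵘ y ≡ ℚ.fromℚᵘ (x ℚᵘ.+ y)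
fromℚᵘ-homo-+ x y = trans (sym (ℚ.fromℚᵘ-toℚᵘ _)) (ℚ.fromℚᵘ-cong (ℚᵘ.≃-trans
  (ℚ.toℚᵘ-homo-+ (ℚ.fromℚᵘ x) (ℚ.fromℚᵘ y)) (ℚᵘ.+-cong (ℚ.toℚᵘ-fromℚᵘ x) (ℚ.toℚᵘ-fromℚᵘ y))))

frac-cross : ∀ a b m n .{{_ : NonZero m}} .{{_ : NonZero n}} → a ℤ.* + n ≡ b ℤ.* + m → frac a m ≡ frac b n
frac-cross a b (suc m) (suc n) eq = ℚ.fromℚᵘ-cong {ℚᵘ.mkℚᵘ a m} {ℚᵘ.mkℚᵘ b n} (ℚᵘ.*≡* eq)

frac-* : ∀ a b m n → frac a (suc m) ℚ.* frac b (suc n) ≡ frac (a ℤ.* b) (suc m * suc n)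
frac-* a b m n = fromℚᵘ-homo-* (ℚᵘ.mkℚᵘ a m) (ℚᵘ.mkℚᵘ b n)

frac-+ : ∀ a b m n → frac a (suc m) ℚ.+ frac b (suc n) ≡ frac (a ℤ.* + suc n ℤ.+ b ℤ.* + suc m) (suc m * suc n)
frac-+ a b m n = fromℚᵘ-homo-+ (ℚᵘ.mkℚᵘ a m) (ℚᵘ.mkℚᵘ b n)

frac-+-same : ∀ a b n → frac (+ a) (suc n) ℚ.+ frac (+ b) (suc n) ≡ frac (+ (a + b)) (suc n)
frac-+-same a b n = trans (frac-+ (+ a) (+ b) n n) (frac-cross (+ a ℤ.* + suc n ℤ.+ + b ℤ.* + suc n) (+ (a + b)) (suc n * suc n) (suc n) (begin
  (+ a ℤ.* s ℤ.+ + b ℤ.* s) ℤ.* s ≡⟨ solve 3 (λ a b s → (a :* s :+ b :* s) :* s := (a :+ b) :* (s :* s)) refl (+ a) (+ b) s ⟩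
  (+ a ℤ.+ + b) ℤ.* (s ℤ.* s)     ≡⟨ cong₂ ℤ._*_ (ℤ.pos-+ a b) (ℤ.pos-* (suc n) (suc n)) ⟨
  + (a + b) ℤ.* + (suc n * suc n) ∎))
  where
  open ≡-Reasoning
  open ℤSolver
  s : ℤ.ℤ
  s = + suc n

denominator≡1⇔∣ : ∀ s n → ℚ.denominatorℕ (frac (+ s) (suc n)) ≡ 1 ⇔ suc n ∣ s
denominator≡1⇔∣ s n = mk⇔
  (λ den≡1 → subst (_∣ s) (trans (sym (*-identityˡ _)) (trans (cong (_* gcd s (suc n)) (sym den≡1)) den*gcd))
                   (gcd[m,n]∣m s (suc n)))
  (λ n∣s → *-cancelʳ-≡ (ℚ.denominatorℕ (frac (+ s) (suc n))) 1 (suc n)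
     (trans (cong (ℚ.denominatorℕ (frac (+ s) (suc n)) *_) (sym (gcd≡n n∣s)))
            (trans den*gcd (sym (*-identityˡ (suc n))))))
  where
  den*gcd : ℚ.denominatorℕ (frac (+ s) (suc n)) * gcd s (suc n) ≡ suc n
  den*gcd = ℤ.+-injective (trans (ℤ.pos-* (ℚ.denominatorℕ (frac (+ s) (suc n))) (gcd s (suc n))) (ℚ.↧-/ (+ s) (suc n)))
  gcd≡n : suc n ∣ s → gcd s (suc n) ≡ suc n
  gcd≡n n∣s = ∣-antisym (gcd[m,n]∣n s (suc n)) (gcd-greatest n∣s ∣-refl)

ι : ℕ → ℚ
ι n = frac (+ n) 1

ι-+ : ∀ m n → ι (m + n) ≡ ι m ℚ.+ ι n
ι-+ m n = sym (trans (frac-+ (+ m) (+ n) 0 0) (frac-cross (+ m ℤ.* + 1 ℤ.+ + n ℤ.* + 1) (+ (m + n)) 1 1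
  (cong (ℤ._* + 1) (trans (cong₂ ℤ._+_ (ℤ.*-identityʳ (+ m)) (ℤ.*-identityʳ (+ n))) (sym (ℤ.pos-+ m n))))))

ι-* : ∀ m n → ι (m * n) ≡ ι m ℚ.* ι n
ι-* m n = sym (trans (frac-* (+ m) (+ n) 0 0) (frac-cross (+ m ℤ.* + n) (+ (m * n)) 1 1 (cong (ℤ._* + 1) (sym (ℤ.pos-* m n)))))

ι-length-filter : ∀ {B : Set} {P : B → Set} (P? : ∀ x → Dec (P x)) xs →
                  ι (length (filter P? xs)) ≡ ∑[ x ∈ xs ] when (P? x) ℚ.1ℚ
ι-length-filter P? []       = refl
ι-length-filter P? (x ∷ xs) with P? x
... | yes _ = trans (ι-+ 1 (length (filter P? xs))) (cong (ℚ.1ℚ ℚ.+_) (ι-length-filter P? xs))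
... | no _  = trans (ι-length-filter P? xs) (sym (ℚ.+-identityˡ _))

∑<-const : ∀ n (c : ℚ) → ∑[ i < n ] c ≡ ι n ℚ.* c
∑<-const zero    c = sym (ℚ.*-zeroˡ c)
∑<-const (suc n) c = begin
  c ℚ.+ ∑[ i < n ] c      ≡⟨ cong₂ ℚ._+_ (sym (ℚ.*-identityˡ c)) (∑<-const n c) ⟩
  ℚ.1ℚ ℚ.* c ℚ.+ ι n ℚ.* c ≡⟨ ℚ.*-distribʳ-+ c ℚ.1ℚ (ι n) ⟨
  (ℚ.1ℚ ℚ.+ ι n) ℚ.* c     ≡⟨ cong (ℚ._* c) (ι-+ 1 n) ⟨
  ι (suc n) ℚ.* c          ∎
  where open ≡-Reasoning

∑<-- : ∀ n (f g : ℕ → ℚ) → ∑[ i < n ] (f i ℚ.- g i) ≡ ∑< n f ℚ.- ∑< n g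
∑<-- zero    f g = refl
∑<-- (suc n) f g = trans (cong (f 0 ℚ.- g 0 ℚ.+_) (∑<-- n (λ i → f (suc i)) (λ i → g (suc i))))
  (solve 4 (λ a b c d → (a :- b) :+ (c :- d) := (a :+ c) :- (b :+ d)) refl (f 0) (g 0) _ _)
  where open ℚSolver

open ArithmeticFunctions using (φ-*-prime; φ>0; μ-*-prime)

-- Weights and their local factors

μ/φ : ℕ → ℚ
μ/φ r = frac (μ r) (φ r)

totientRatio : ℕ → ℚ
totientRatio n = frac (+ n) (φ n)

μ/φ-*-prime : ∀ {p b} .{{_ : NonZero b}} → Prime p → ¬ p ∣ b →
              μ/φ (p * b) ≡ frac ℤ.-1ℤ (p ∸ 1) ℚ.* μ/φ b
μ/φ-*-prime {p@(suc (suc t))} {b} pp p∤b with φ b in φb≡ | φ>0 b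
... | suc u | _ = begin
  frac (μ (p * b)) (φ (p * b))              ≡⟨ cong₂ frac (μ-*-prime pp p∤b)
                                                 (trans (φ-*-prime pp p∤b) (cong (suc t *_) φb≡)) ⟩
  frac (ℤ.-1ℤ ℤ.* μ b) (suc t * suc u)      ≡⟨ frac-* ℤ.-1ℤ (μ b) t u ⟨
  frac ℤ.-1ℤ (suc t) ℚ.* frac (μ b) (suc u) ∎
  where open ≡-Reasoning

totientRatio-*-prime : ∀ {p b} .{{_ : NonZero b}} → Prime p → ¬ p ∣ b →
                       totientRatio (p * b) ≡ frac (+ p) (p ∸ 1) ℚ.* totientRatio b
totientRatio-*-prime {p@(suc (suc t))} {b} pp p∤b with φ b in φb≡ | φ>0 b
... | suc u | _ = begin
  frac (+ (p * b)) (φ (p * b))              ≡⟨ cong₂ frac (ℤ.pos-* p b)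
                                                 (trans (φ-*-prime pp p∤b) (cong (suc t *_) φb≡)) ⟩
  frac (+ p ℤ.* + b) (suc t * suc u)        ≡⟨ frac-* (+ p) (+ b) t u ⟨
  frac (+ p) (suc t) ℚ.* frac (+ b) (suc u) ∎
  where open ≡-Reasoning

weight : (q : ℕ) .{{_ : NonZero q}} → ℕ → ℚ
weight q x = μ/φ ((q / gcd x q) {{gcd-nonZero x q}})

localWeight : ℕ → ℕ → ℚ
localWeight p x with p ∣? x
... | yes _ = ℚ.1ℚ
... | no _  = frac ℤ.-1ℤ (p ∸ 1)

module _ {p m : ℕ} .{{_ : NonZero m}} (pp : Prime p) (p∤m : ¬ p ∣ m) where

  private
    instance
      p≢0 : NonZero p
      p≢0 = prime⇒nonZero pp
      pm≢0 : NonZero (p * m)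
      pm≢0 = m*n≢0 p m
    open ≡-Reasoning

  weight-*-prime : ∀ x → weight (p * m) x ≡ localWeight p x ℚ.* weight m x
  weight-*-prime x with p ∣? x
  ... | yes p∣x = begin
    μ/φ ((p * m / gcd x (p * m)) {{gcd-nonZero x (p * m)}})
      ≡⟨ cong μ/φ (/-congʳ {{gcd-nonZero x (p * m)}} {{pg≢0}} (gcd[m,p*n]≡p*gcd[m,n] (prime-∤⇒coprime pp p∤m) p∣x)) ⟩
    μ/φ ((p * m / (p * gcd x m)) {{pg≢0}})
      ≡⟨ cong μ/φ (m*n/m*o≡n/o p m (gcd x m) {{g≢0}} {{pg≢0}}) ⟩
    weight m x
      ≡⟨ ℚ.*-identityˡ (weight m x) ⟨
    ℚ.1ℚ ℚ.* weight m x
      ∎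
    where
    g≢0 : NonZero (gcd x m)
    g≢0 = gcd-nonZero x m
    pg≢0 : NonZero (p * gcd x m)
    pg≢0 = m*n≢0 p (gcd x m) {{p≢0}} {{g≢0}}
  ... | no p∤x = begin
    μ/φ ((p * m / gcd x (p * m)) {{gcd-nonZero x (p * m)}})
      ≡⟨ cong μ/φ (/-congʳ {{gcd-nonZero x (p * m)}} {{g≢0}} (gcd[m,p*n]≡gcd[m,n] pp p∤x)) ⟩
    μ/φ ((p * m / gcd x m) {{g≢0}})
      ≡⟨ cong μ/φ (*-/-assoc p {{g≢0}} g∣m) ⟩
    μ/φ (p * (m / gcd x m) {{g≢0}})
      ≡⟨ μ/φ-*-prime {{m/g≢0}} pp (λ p∣m/g → p∤m (∣-trans p∣m/g (m/n∣m {{g≢0}} g∣m))) ⟩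
    frac ℤ.-1ℤ (p ∸ 1) ℚ.* weight m x
      ∎
    where
    g≢0 : NonZero (gcd x m)
    g≢0 = gcd-nonZero x m
    g∣m : gcd x m ∣ m
    g∣m = gcd[m,n]∣n x m
    m/g≢0 : NonZero ((m / gcd x m) {{g≢0}})
    m/g≢0 = ℕ.≢-nonZero (λ m/g≡0 → ℕ.≢-nonZero⁻¹ m
      (trans (sym (m/n*n≡m {{g≢0}} g∣m)) (cong (_* gcd x m) m/g≡0)))

divisibility : ℕ → ℕ → ℚ
divisibility n s = when (n ∣? s) ℚ.1ℚ

divisibility-* : ∀ {m n} s → Coprime m n → divisibility (m * n) s ≡ divisibility m s ℚ.* divisibility n s
divisibility-* {m} {n} s m⊥n with m ∣? s | n ∣? s | (m * n) ∣? s
... | yes _   | yes _   | yes _    = sym (ℚ.*-identityˡ ℚ.1ℚ)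
... | yes m∣s | yes n∣s | no mn∤s  = contradiction (coprime-*-∣ m⊥n m∣s n∣s) mn∤s
... | no m∤s  | _       | yes mn∣s = contradiction (∣-trans (m∣m*n n) mn∣s) m∤s
... | _       | no n∤s  | yes mn∣s = contradiction (∣-trans (n∣m*n m) mn∣s) n∤s
... | no _    | yes _   | no _     = sym (ℚ.*-zeroˡ ℚ.1ℚ)
... | yes _   | no _    | no _     = sym (ℚ.*-zeroʳ ℚ.1ℚ)
... | no _    | no _    | no _     = sym (ℚ.*-zeroˡ ℚ.0ℚ)

∣[m+n]⇔∣m : ∀ n m → n ∣ m + n ⇔ n ∣ m
∣[m+n]⇔∣m n m = mk⇔ (λ n∣m+n → ∣m+n∣m⇒∣n (subst (n ∣_) (+-comm m n) n∣m+n) ∣-refl)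
                    (λ n∣m → ∣m∣n⇒∣m+n n∣m ∣-refl)

divisibility-periodic : ∀ n → Periodic n (divisibility n)
divisibility-periodic n x = when-⇔ (n ∣? (x + n)) (n ∣? x) (Equivalence.to (∣[m+n]⇔∣m n x))
                                                           (Equivalence.from (∣[m+n]⇔∣m n x))

localWeight-periodic : ∀ p → Periodic p (localWeight p)
localWeight-periodic p x with p ∣? (x + p) | p ∣? x
... | yes _     | yes _   = refl
... | no _      | no _    = refl
... | yes p∣x+p | no p∤x  = contradiction (Equivalence.to (∣[m+n]⇔∣m p x) p∣x+p) p∤x
... | no p∤x+p  | yes p∣x = contradiction (Equivalence.from (∣[m+n]⇔∣m p x) p∣x) p∤x+p

weight-periodic : ∀ q .{{_ : NonZero q}} → Periodic q (weight q)
weight-periodic q x =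
  cong μ/φ (/-congʳ {{gcd-nonZero (x + q) q}} {{gcd-nonZero x q}} (gcd[m+n,n]≡gcd[m,n] x q))

zeroSumPairs : ℕ → (ℕ → ℚ) → ℚ
zeroSumPairs n f = ∑[ x < n ] ∑[ y < n ] (f x ℚ.* f y ℚ.* divisibility n (x + y))

zeroSumTriples : ℕ → (ℕ → ℚ) → ℚ
zeroSumTriples n f =
  ∑[ x < n ] ∑[ y < n ] ∑[ z < n ] (f x ℚ.* f y ℚ.* f z ℚ.* divisibility n (x + y + z))

module _ (n : ℕ) {f : ℕ → ℚ} (f-per : Periodic n f) where

  private
    divisibility-shift : ∀ {s t} → s ≡ t + n → divisibility n s ≡ divisibility n t
    divisibility-shift s≡t+n = trans (cong (divisibility n) s≡t+n) (divisibility-periodic n _)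

    open Data.Nat.Solver.+-*-Solver

  pair-periodicˣ : ∀ y → Periodic n (λ x → f x ℚ.* f y ℚ.* divisibility n (x + y))
  pair-periodicˣ y x = cong₂ ℚ._*_ (cong (ℚ._* f y) (f-per x))
    (divisibility-shift (solve 3 (λ x y n → (x :+ n) :+ y := (x :+ y) :+ n) refl x y n))

  pair-periodicʸ : ∀ x → Periodic n (λ y → f x ℚ.* f y ℚ.* divisibility n (x + y))
  pair-periodicʸ x y = cong₂ ℚ._*_ (cong (f x ℚ.*_) (f-per y)) (divisibility-shift (sym (+-assoc x y n)))

  triple-periodicˣ : ∀ y z → Periodic n (λ x → f x ℚ.* f y ℚ.* f z ℚ.* divisibility n (x + y + z))
  triple-periodicˣ y z x = cong₂ ℚ._*_ (cong (λ t → t ℚ.* f y ℚ.* f z) (f-per x))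
    (divisibility-shift (solve 4 (λ x y z n → (x :+ n) :+ y :+ z := (x :+ y :+ z) :+ n) refl x y z n))

  triple-periodicʸ : ∀ x z → Periodic n (λ y → f x ℚ.* f y ℚ.* f z ℚ.* divisibility n (x + y + z))
  triple-periodicʸ x z y = cong₂ ℚ._*_ (cong (λ t → f x ℚ.* t ℚ.* f z) (f-per y))
    (divisibility-shift (solve 4 (λ x y z n → x :+ (y :+ n) :+ z := (x :+ y :+ z) :+ n) refl x y z n))

  triple-periodicᶻ : ∀ x y → Periodic n (λ z → f x ℚ.* f y ℚ.* f z ℚ.* divisibility n (x + y + z))
  triple-periodicᶻ x y z = cong₂ ℚ._*_ (cong (f x ℚ.* f y ℚ.*_) (f-per z))
    (divisibility-shift (sym (+-assoc (x + y) z n)))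

module _ (n m : ℕ) .{{_ : NonZero n}} (n⊥m : Coprime n m) {f g h : ℕ → ℚ}
         (f-per : Periodic n f) (g-per : Periodic m g) (h≗fg : ∀ x → h x ≡ f x ℚ.* g x) where

  open ℚSolver

  zeroSumPairs-* : zeroSumPairs (n * m) h ≡ zeroSumPairs n f ℚ.* zeroSumPairs m g
  zeroSumPairs-* = trans
    (∑<-cong (n * m) (λ x _ → ∑<-cong (n * m) (λ y _ → trans
      (cong₂ ℚ._*_ (cong₂ ℚ._*_ (h≗fg x) (h≗fg y)) (divisibility-* (x + y) n⊥m))
      (solve 6 (λ a b c d e f → ((a :* b) :* (c :* d)) :* (e :* f) := ((a :* c) :* e) :* ((b :* d) :* f))
             refl (f x) (g x) (f y) (g y) (divisibility n (x + y)) (divisibility m (x + y))))))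
    (∑<-crt² n m n⊥m _ _ (pair-periodicˣ n f-per) (pair-periodicʸ n f-per)
                         (pair-periodicˣ m g-per) (pair-periodicʸ m g-per))

  zeroSumTriples-* : zeroSumTriples (n * m) h ≡ zeroSumTriples n f ℚ.* zeroSumTriples m g
  zeroSumTriples-* = trans
    (∑<-cong (n * m) (λ x _ → ∑<-cong (n * m) (λ y _ → ∑<-cong (n * m) (λ z _ → trans
      (cong₂ ℚ._*_ (cong₂ ℚ._*_ (cong₂ ℚ._*_ (h≗fg x) (h≗fg y)) (h≗fg z)) (divisibility-* (x + y + z) n⊥m))
      (solve 8 (λ a b c d e f g h → (((a :* b) :* (c :* d)) :* (e :* f)) :* (g :* h)
                                    := (((a :* c) :* e) :* g) :* (((b :* d) :* f) :* h))
             refl (f x) (g x) (f y) (g y) (f z) (g z) (divisibility n (x + y + z)) (divisibility m (x + y + z)))))))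
    (∑<-crt³ n m n⊥m _ _ (triple-periodicˣ n f-per) (triple-periodicʸ n f-per) (triple-periodicᶻ n f-per)
                         (triple-periodicˣ m g-per) (triple-periodicʸ m g-per) (triple-periodicᶻ m g-per))

∑-divisibility-select : ∀ n .{{_ : NonZero n}} s (h : ℕ → ℚ) →
                        ∃[ z₀ ] (n ∣ s + z₀ × ∑[ z < n ] (h z ℚ.* divisibility n (s + z)) ≡ h z₀)
∑-divisibility-select n s h with affine-mod-surjective n 1 (coprime-1 n) s (ℕ.>-nonZero⁻¹ n)
... | z₀ , z₀<n , [z₀+s]%n≡0 = z₀ , n∣s+z₀ , trans (∑<-single n _ z₀<n others) selected
  where
  shape : ∀ z → z * 1 + s ≡ s + z
  shape z = trans (cong (_+ s) (*-identityʳ z)) (+-comm z s)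
  n∣s+z₀ : n ∣ s + z₀
  n∣s+z₀ = subst (n ∣_) (shape z₀) (m%n≡0⇒n∣m _ n [z₀+s]%n≡0)
  others : ∀ z → z < n → z ≢ z₀ → h z ℚ.* divisibility n (s + z) ≡ ℚ.0ℚ
  others z z<n z≢z₀ = trans (cong (h z ℚ.*_) (when-no (n ∣? (s + z)) (λ n∣s+z → z≢z₀
    (affine-mod-injective n 1 (coprime-1 n) s z<n z₀<n
      (trans (n∣m⇒m%n≡0 _ n (subst (n ∣_) (sym (shape z)) n∣s+z)) (sym [z₀+s]%n≡0))))))
    (ℚ.*-zeroʳ (h z))
  selected : h z₀ ℚ.* divisibility n (s + z₀) ≡ h z₀
  selected = trans (cong (h z₀ ℚ.*_) (when-yes (n ∣? (s + z₀)) n∣s+z₀)) (ℚ.*-identityʳ (h z₀))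

localWeight-∣+ : ∀ p {a b} → p ∣ a + b → localWeight p a ≡ localWeight p b
localWeight-∣+ p {a} {b} p∣a+b with p ∣? a | p ∣? b
... | yes _   | yes _   = refl
... | no _    | no _    = refl
... | yes p∣a | no p∤b  = contradiction (∣m+n∣m⇒∣n p∣a+b p∣a) p∤b
... | no p∤a  | yes p∣b = contradiction (∣m+n∣m⇒∣n (subst (p ∣_) (+-comm a b) p∣a+b) p∣b) p∤a

module LocalFactors (t : ℕ) (pp : Prime (2 + t)) where

  private
    p : ℕ
    p = 2 + t
    γ : ℕ → ℚ
    γ = localWeight p
    c e k : ℚ
    c = frac ℤ.-1ℤ (suc t)
    e = frac (+ p) (suc t)
    k = ι (suc t)
    open ≡-Reasoning
    open ℚSolver

  γ[1+i]≡c : ∀ {i} → i < suc t → γ (suc i) ≡ c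
  γ[1+i]≡c {i} i<p-1 with p ∣? suc i
  ... | no _    = refl
  ... | yes p∣x = contradiction (∣⇒≤ p∣x) (<⇒≱ (s≤s i<p-1))

  k*c≡-1 : k ℚ.* c ≡ ℚ.- ℚ.1ℚ
  k*c≡-1 = trans (frac-* (+ suc t) ℤ.-1ℤ 0 t) (frac-cross (+ suc t ℤ.* ℤ.-1ℤ) ℤ.-1ℤ (1 * suc t) 1
    (trans (ZS.solve 1 (λ s → (s ZS.:* ZS.con ℤ.-1ℤ) ZS.:* ZS.con (+ 1) ZS.:= ZS.con ℤ.-1ℤ ZS.:* s) refl (+ suc t))
           (cong (λ w → ℤ.-1ℤ ℤ.* + w) (sym (*-identityˡ (suc t))))))
    where module ZS = ℤSolver

  e≡1-c : e ≡ ℚ.1ℚ ℚ.- c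
  e≡1-c = trans (solve 2 (λ e c → e := (e :+ c) :- c) refl e c) (cong (ℚ._- c) e+c≡1)
    where
    s : ℤ.ℤ
    s = + suc t
    module ZS = ℤSolver
    e+c≡1 : e ℚ.+ c ≡ ℚ.1ℚ
    e+c≡1 = trans (frac-+ (+ p) ℤ.-1ℤ t t)
      (frac-cross (+ p ℤ.* s ℤ.+ ℤ.-1ℤ ℤ.* s) (+ 1) (suc t * suc t) 1 (begin
        (+ p ℤ.* s ℤ.+ ℤ.-1ℤ ℤ.* s) ℤ.* + 1
          ≡⟨ cong (λ w → (w ℤ.* s ℤ.+ ℤ.-1ℤ ℤ.* s) ℤ.* + 1) (ℤ.pos-+ 1 (suc t)) ⟩
        ((+ 1 ℤ.+ s) ℤ.* s ℤ.+ ℤ.-1ℤ ℤ.* s) ℤ.* + 1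
          ≡⟨ ZS.solve 1 (λ s → ((ZS.con (+ 1) ZS.:+ s) ZS.:* s ZS.:+ ZS.con ℤ.-1ℤ ZS.:* s) ZS.:* ZS.con (+ 1)
                               ZS.:= ZS.con (+ 1) ZS.:* (s ZS.:* s)) refl s ⟩
        + 1 ℤ.* (s ℤ.* s)
          ≡⟨ cong (+ 1 ℤ.*_) (ℤ.pos-* (suc t) (suc t)) ⟨
        + 1 ℤ.* + (suc t * suc t) ∎))

  ∑γ≡0 : ∑< p γ ≡ ℚ.0ℚ
  ∑γ≡0 = begin
    ℚ.1ℚ ℚ.+ ∑[ i < suc t ] γ (suc i) ≡⟨ cong (ℚ.1ℚ ℚ.+_) (trans (∑<-cong (suc t) (λ i → γ[1+i]≡c))
                                                               (∑<-const (suc t) c)) ⟩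
    ℚ.1ℚ ℚ.+ k ℚ.* c                   ≡⟨ cong (ℚ.1ℚ ℚ.+_) k*c≡-1 ⟩
    ℚ.1ℚ ℚ.+ ℚ.- ℚ.1ℚ                  ≡⟨ ℚ.+-inverseʳ ℚ.1ℚ ⟩
    ℚ.0ℚ                               ∎

  correlation : ℕ → ℚ
  correlation x = ∑[ y < p ] (γ y ℚ.* γ (x + y))

  correlation[0]≡e : correlation 0 ≡ e
  correlation[0]≡e = begin
    ℚ.1ℚ ℚ.* ℚ.1ℚ ℚ.+ ∑[ i < suc t ] (γ (suc i) ℚ.* γ (suc i))
      ≡⟨ cong (ℚ.1ℚ ℚ.* ℚ.1ℚ ℚ.+_) (trans (∑<-cong (suc t) (λ i i< → cong₂ ℚ._*_ (γ[1+i]≡c i<) (γ[1+i]≡c i<)))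
                                         (∑<-const (suc t) (c ℚ.* c))) ⟩
    ℚ.1ℚ ℚ.* ℚ.1ℚ ℚ.+ k ℚ.* (c ℚ.* c)
      ≡⟨ solve 2 (λ k c → con ℚ.1ℚ :* con ℚ.1ℚ :+ k :* (c :* c) := con ℚ.1ℚ :+ (k :* c) :* c) refl k c ⟩
    ℚ.1ℚ ℚ.+ (k ℚ.* c) ℚ.* c ≡⟨ cong (λ w → ℚ.1ℚ ℚ.+ w ℚ.* c) k*c≡-1 ⟩
    ℚ.1ℚ ℚ.+ ℚ.- ℚ.1ℚ ℚ.* c  ≡⟨ solve 1 (λ c → con ℚ.1ℚ :+ (:- con ℚ.1ℚ) :* c := con ℚ.1ℚ :- c) refl c ⟩
    ℚ.1ℚ ℚ.- c               ≡⟨ e≡1-c ⟨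
    e                        ∎

  ∑γ[s+y]≡0 : ∀ s → ∑[ y < p ] γ (s + y) ≡ ℚ.0ℚ
  ∑γ[s+y]≡0 s = trans
    (∑<-cong p (λ y _ → cong γ (trans (+-comm s y) (cong (_+ s) (sym (*-identityʳ y))))))
    (trans (∑<-periodic-affine p 1 (coprime-1 p) γ (localWeight-periodic p) s) ∑γ≡0)

  correlation[1+i]≡c-c² : ∀ {i} → i < suc t → correlation (suc i) ≡ c ℚ.- c ℚ.* c
  correlation[1+i]≡c-c² {i} i<p-1 = begin
    γ 0 ℚ.* γ (suc i + 0) ℚ.+ ∑[ j < suc t ] (γ (suc j) ℚ.* γ (suc i + suc j))
      ≡⟨ cong₂ ℚ._+_ (cong (ℚ.1ℚ ℚ.*_) γ[1+i+0]≡c)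
                     (trans (∑<-cong (suc t) (λ j j< → cong (ℚ._* γ (suc i + suc j)) (γ[1+i]≡c j<)))
                            (∑<-*ˡ c (suc t) (λ j → γ (suc i + suc j)))) ⟩
    ℚ.1ℚ ℚ.* c ℚ.+ c ℚ.* ∑[ j < suc t ] γ (suc i + suc j)
      ≡⟨ cong (λ w → ℚ.1ℚ ℚ.* c ℚ.+ c ℚ.* w) tail≡-c ⟩
    ℚ.1ℚ ℚ.* c ℚ.+ c ℚ.* (ℚ.0ℚ ℚ.- c)
      ≡⟨ solve 1 (λ c → con ℚ.1ℚ :* c :+ c :* (con ℚ.0ℚ :- c) := c :- c :* c) refl c ⟩
    c ℚ.- c ℚ.* c ∎
    where
    γ[1+i+0]≡c : γ (suc i + 0) ≡ c
    γ[1+i+0]≡c = trans (cong γ (+-identityʳ (suc i))) (γ[1+i]≡c i<p-1)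
    tail≡-c : ∑[ j < suc t ] γ (suc i + suc j) ≡ ℚ.0ℚ ℚ.- c
    tail≡-c = begin
      ∑[ j < suc t ] γ (suc i + suc j)
        ≡⟨ solve 2 (λ a r → r := (a :+ r) :- a) refl (γ (suc i + 0)) _ ⟩
      ∑[ y < p ] γ (suc i + y) ℚ.- γ (suc i + 0)
        ≡⟨ cong₂ ℚ._-_ (∑γ[s+y]≡0 (suc i)) γ[1+i+0]≡c ⟩
      ℚ.0ℚ ℚ.- c ∎

  zeroSumPairs-prime : zeroSumPairs p γ ≡ e
  zeroSumPairs-prime = trans (∑<-cong p (λ x _ → select x)) correlation[0]≡e
    where
    select : ∀ x → ∑[ y < p ] (γ x ℚ.* γ y ℚ.* divisibility p (x + y)) ≡ γ x ℚ.* γ x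
    select x with ∑-divisibility-select p x (λ y → γ x ℚ.* γ y)
    ... | y₀ , p∣x+y₀ , sum≡ = trans sum≡ (cong (γ x ℚ.*_) (sym (localWeight-∣+ p {x} {y₀} p∣x+y₀)))

  zeroSumTriples-prime : zeroSumTriples p γ ≡ e ℚ.* e
  zeroSumTriples-prime = begin
    zeroSumTriples p γ
      ≡⟨ ∑<-cong p (λ x _ → ∑<-cong p (λ y _ → select x y)) ⟩
    ∑[ x < p ] ∑[ y < p ] (γ x ℚ.* γ y ℚ.* γ (x + y))
      ≡⟨ ∑<-cong p (λ x _ → trans (∑<-cong p (λ y _ → ℚ.*-assoc (γ x) (γ y) (γ (x + y)))) (∑<-*ˡ (γ x) p (λ y → γ y ℚ.* γ (x + y)))) ⟩
    ∑[ x < p ] (γ x ℚ.* correlation x)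
      ≡⟨ cong₂ ℚ._+_ (cong (ℚ.1ℚ ℚ.*_) correlation[0]≡e)
           (trans (∑<-cong (suc t) (λ i i< → cong₂ ℚ._*_ (γ[1+i]≡c i<) (correlation[1+i]≡c-c² i<)))
                  (∑<-const (suc t) _)) ⟩
    ℚ.1ℚ ℚ.* e ℚ.+ k ℚ.* (c ℚ.* (c ℚ.- c ℚ.* c))
      ≡⟨ solve 3 (λ e k c → con ℚ.1ℚ :* e :+ k :* (c :* (c :- c :* c)) := e :+ (k :* c) :* (c :- c :* c)) refl e k c ⟩
    e ℚ.+ (k ℚ.* c) ℚ.* (c ℚ.- c ℚ.* c)
      ≡⟨ cong₂ (λ u w → u ℚ.+ w ℚ.* (c ℚ.- c ℚ.* c)) e≡1-c k*c≡-1 ⟩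
    (ℚ.1ℚ ℚ.- c) ℚ.+ ℚ.- ℚ.1ℚ ℚ.* (c ℚ.- c ℚ.* c)
      ≡⟨ solve 1 (λ c → (con ℚ.1ℚ :- c) :+ (:- con ℚ.1ℚ) :* (c :- c :* c) := (con ℚ.1ℚ :- c) :* (con ℚ.1ℚ :- c)) refl c ⟩
    (ℚ.1ℚ ℚ.- c) ℚ.* (ℚ.1ℚ ℚ.- c)
      ≡⟨ cong₂ ℚ._*_ e≡1-c e≡1-c ⟨
    e ℚ.* e ∎
    where
    select : ∀ x y → ∑[ z < p ] (γ x ℚ.* γ y ℚ.* γ z ℚ.* divisibility p (x + y + z)) ≡ γ x ℚ.* γ y ℚ.* γ (x + y)
    select x y with ∑-divisibility-select p (x + y) (λ z → γ x ℚ.* γ y ℚ.* γ z)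
    ... | z₀ , p∣x+y+z₀ , sum≡ = trans sum≡ (cong (γ x ℚ.* γ y ℚ.*_) (sym (localWeight-∣+ p {x + y} {z₀} p∣x+y+z₀)))

-- From fractions to residues

∑∈-bigDivisors : ∀ q (h : ℕ → ℚ) → ∑∈ (bigDivisors q) h ≡ ∑[ i < q ∸ 1 ] when (2 + i ∣? q) (h (2 + i))
∑∈-bigDivisors q h = trans (∑∈-filter (_∣? q) (range 2 q) h)
  (trans (cong (λ rs → ∑[ r ∈ rs ] when (r ∣? q) (h r)) (range≡interval 2 q)) (∑∈-interval (q ∸ 1) 2 _))

∑∈-units : ∀ r (h : ℕ → ℚ) → ∑∈ (units r) h ≡ ∑[ j < r ] when (gcd (suc j) r ℕ.≟ 1) (h (suc j))
∑∈-units r h = trans (∑∈-filter (λ a → gcd a r ℕ.≟ 1) (range 1 r) h)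
  (trans (cong (λ as → ∑[ a ∈ as ] when (gcd a r ℕ.≟ 1) (h a)) (range≡interval 1 r)) (∑∈-interval r 1 _))

weightedFraction : ℕ → ℕ → ℚ × ℚ
weightedFraction a r = μ/φ r , frac (+ a) r

weightedResidue : (q : ℕ) .{{_ : NonZero q}} → ℕ → ℚ × ℚ
weightedResidue q x = weight q x , frac (+ x) q

module Reparametrisation (q : ℕ) .{{_ : NonZero q}} where

  open ≡-Reasoning

  module _ {r a : ℕ} .{{_ : NonZero r}} (r∣q : r ∣ q) (a⊥r : gcd a r ≡ 1) where

    private
      q≡r*[q/r] : q ≡ r * (q / r)
      q≡r*[q/r] = sym (m*[n/m]≡n r∣q)

    instance
      gcd[a*[q/r],q]≢0 : NonZero (gcd (a * (q / r)) q)
      gcd[a*[q/r],q]≢0 = gcd-nonZero (a * (q / r)) q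
      q/r≢0 : NonZero (q / r)
      q/r≢0 = ℕ.≢-nonZero (λ q/r≡0 → ℕ.≢-nonZero⁻¹ q (trans q≡r*[q/r] (trans (cong (r *_) q/r≡0) (*-zeroʳ r))))

    gcd[a*[q/r],q]≡q/r : gcd (a * (q / r)) q ≡ q / r
    gcd[a*[q/r],q]≡q/r = begin
      gcd (a * (q / r)) q             ≡⟨ cong (gcd (a * (q / r))) q≡r*[q/r] ⟩
      gcd (a * (q / r)) (r * (q / r)) ≡⟨ gcd[m*o,n*o]≡gcd[m,n]*o a r (q / r) ⟩
      gcd a r * (q / r)               ≡⟨ cong (_* (q / r)) a⊥r ⟩
      1 * (q / r)                     ≡⟨ *-identityˡ (q / r) ⟩
      q / r                           ∎

    denominator-of-a*[q/r] : q / gcd (a * (q / r)) q ≡ r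
    denominator-of-a*[q/r] = trans (/-congʳ gcd[a*[q/r],q]≡q/r)
      (trans (/-congˡ {o = q / r} q≡r*[q/r]) (m*n/n≡m r (q / r)))

    numerator-of-a*[q/r] : a * (q / r) / gcd (a * (q / r)) q ≡ a
    numerator-of-a*[q/r] = trans (/-congʳ gcd[a*[q/r],q]≡q/r) (m*n/n≡m a (q / r))

    frac[a,r]≡frac[a*[q/r],q] : frac (+ a) r ≡ frac (+ (a * (q / r))) q
    frac[a,r]≡frac[a*[q/r],q] = frac-cross (+ a) (+ (a * (q / r))) r q (begin
      + a ℤ.* + q              ≡⟨ ℤ.pos-* a q ⟨
      + (a * q)                ≡⟨ cong (λ n → + (a * n)) (trans q≡r*[q/r] (*-comm r (q / r))) ⟩
      + (a * ((q / r) * r))    ≡⟨ cong +_ (*-assoc a (q / r) r) ⟨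
      + (a * (q / r) * r)      ≡⟨ ℤ.pos-* (a * (q / r)) r ⟩
      + (a * (q / r)) ℤ.* + r  ∎)

    a*[q/r]-bounds : 2 ≤ r → 1 ≤ a → a ≤ r → 1 ≤ a * (q / r) × a * (q / r) < q
    a*[q/r]-bounds 2≤r 1≤a a≤r = ≤-trans 1≤a (m≤m*n a (q / r)) ,
      subst (a * (q / r) <_) (sym q≡r*[q/r]) (*-monoˡ-< (q / r) a<r)
      where
      a<r : a < r
      a<r with m≤n⇒m<n∨m≡n a≤r
      ... | inj₁ a<r  = a<r
      ... | inj₂ refl = contradiction (trans (sym (gcd[n,n]≡n a)) a⊥r) (>⇒≢ 2≤r)

  module LowestTerms {x : ℕ} (1≤x : 1 ≤ x) (x<q : x < q) where

    private
      instance
        g≢0 : NonZero (gcd x q)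
        g≢0 = gcd-nonZero x q
      g : ℕ
      g = gcd x q
      g∣q : g ∣ q
      g∣q = gcd[m,n]∣n x q
      g∣x : g ∣ x
      g∣x = gcd[m,n]∣m x q

    r₀ a₀ : ℕ
    r₀ = q / g
    a₀ = x / g

    2≤r₀ : 2 ≤ r₀
    2≤r₀ = subst (1 <_) (sym (n/m≡quotient g∣q))
      (quotient>1 g∣q (≤-<-trans (∣⇒≤ {{ℕ.>-nonZero 1≤x}} g∣x) x<q))

    instance
      r₀≢0 : NonZero r₀
      r₀≢0 = ℕ.>-nonZero (≤-trans (s≤s z≤n) 2≤r₀)

    r₀∣q : r₀ ∣ q
    r₀∣q = m/n∣m g∣q

    r₀≤q : r₀ ≤ q
    r₀≤q = m/n≤m q g

    1≤a₀ : 1 ≤ a₀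
    1≤a₀ = m≥n⇒m/n>0 (∣⇒≤ {{ℕ.>-nonZero 1≤x}} g∣x)

    a₀≤r₀ : a₀ ≤ r₀
    a₀≤r₀ = /-monoˡ-≤ g (<⇒≤ x<q)

    a₀⊥r₀ : gcd a₀ r₀ ≡ 1
    a₀⊥r₀ = coprime⇒gcd≡1 (Coprimality.coprime-/gcd x q)

    a₀*[q/r₀]≡x : a₀ * (q / r₀) ≡ x
    a₀*[q/r₀]≡x = begin
      a₀ * (q / r₀) ≡⟨ cong (a₀ *_) (trans (/-congˡ {o = r₀} (sym (trans (*-comm g r₀) (m/n*n≡m g∣q)))) (m*n/n≡m g r₀)) ⟩
      x / g * g     ≡⟨ m/n*n≡m g∣x ⟩
      x             ∎

  private
    N : ℕ
    N = q ∸ 1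

  module _ (F : ℕ → ℕ → ℚ) (K : ℕ → ℚ)
           (F≡K : ∀ {r a} .{{_ : NonZero r}} → r ∣ q → gcd a r ≡ 1 → 2 ≤ r → 1 ≤ a → a ≤ r →
                  F r a ≡ K (a * (q / r))) where

    private
      -- hit i j k vanishes unless (r, a) = (2 + i, 1 + j) is admissible and a * (q / r) = 1 + k.
      hit : ℕ → ℕ → ℕ → ℚ
      hit i j k = when (2 + i ∣? q) (when (gcd (suc j) (2 + i) ℕ.≟ 1)
                    (when (suc j * (q / (2 + i)) ℕ.≟ suc k) (K (suc k))))

      hit-vanishes : ∀ {i j k} → (2 + i ∣ q → gcd (suc j) (2 + i) ≡ 1 → suc j * (q / (2 + i)) ≡ suc k → ⊥) →
                     hit i j k ≡ ℚ.0ℚ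
      hit-vanishes {i} {j} {k} invalid
        with 2 + i ∣? q | gcd (suc j) (2 + i) ℕ.≟ 1 | suc j * (q / (2 + i)) ℕ.≟ suc k
      ... | yes r∣q | yes a⊥r | yes a*[q/r]≡x = ⊥-elim (invalid r∣q a⊥r a*[q/r]≡x)
      ... | no _    | _       | _             = refl
      ... | yes _   | no _    | _             = refl
      ... | yes _   | yes _   | no _          = refl

      hit-value : ∀ {i j k} → 2 + i ∣ q → gcd (suc j) (2 + i) ≡ 1 → suc j * (q / (2 + i)) ≡ suc k →
                  hit i j k ≡ K (suc k)
      hit-value {i} {j} {k} r∣q a⊥r a*[q/r]≡x = trans (when-yes (2 + i ∣? q) r∣q)
        (trans (when-yes (gcd (suc j) (2 + i) ℕ.≟ 1) a⊥r) (when-yes (suc j * (q / (2 + i)) ℕ.≟ suc k) a*[q/r]≡x))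

      expand : ∀ {r a} .{{_ : NonZero r}} → r ∣ q → gcd a r ≡ 1 → 2 ≤ r → 1 ≤ a → a ≤ r →
               F r a ≡ ∑[ k < N ] when (a * (q / r) ℕ.≟ suc k) (K (suc k))
      expand {r} {a} r∣q a⊥r 2≤r 1≤a a≤r = trans (F≡K r∣q a⊥r 2≤r 1≤a a≤r) (sym (trans
        (∑<-single N _ (∸-monoˡ-< x<q 1≤x) (λ k _ k≢ → when-no (x ℕ.≟ suc k) (λ x≡1+k → k≢ (cong ℕ.pred (sym x≡1+k)))))
        (selected (m+[n∸m]≡n 1≤x))))
        where
        x : ℕ
        x = a * (q / r)
        1≤x : 1 ≤ x
        1≤x = proj₁ (a*[q/r]-bounds r∣q a⊥r 2≤r 1≤a a≤r)
        x<q : x < q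
        x<q = proj₂ (a*[q/r]-bounds r∣q a⊥r 2≤r 1≤a a≤r)
        selected : ∀ {y} → y ≡ x → when (x ℕ.≟ y) (K y) ≡ K x
        selected refl = when-yes (x ℕ.≟ x) refl

      row : ∀ i → when (2 + i ∣? q) (∑[ a ∈ units (2 + i) ] F (2 + i) a) ≡ ∑[ j < 2 + i ] ∑[ k < N ] hit i j k
      row i = begin
        when (r ∣? q) (∑[ a ∈ units r ] F r a)
          ≡⟨ cong (when (r ∣? q)) (∑∈-units r (F r)) ⟩
        when (r ∣? q) (∑[ j < r ] when (gcd (suc j) r ℕ.≟ 1) (F r (suc j)))
          ≡⟨ ∑<-when (r ∣? q) r (λ j → when (gcd (suc j) r ℕ.≟ 1) (F r (suc j))) ⟩
        ∑[ j < r ] when (r ∣? q) (when (gcd (suc j) r ℕ.≟ 1) (F r (suc j)))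
          ≡⟨ ∑<-cong r (λ j j<r → when-cong (r ∣? q) (λ r∣q → when-cong (gcd (suc j) r ℕ.≟ 1) (λ a⊥r →
               expand r∣q a⊥r (s≤s (s≤s z≤n)) (s≤s z≤n) j<r))) ⟩
        ∑[ j < r ] when (r ∣? q) (when (gcd (suc j) r ℕ.≟ 1) (∑[ k < N ] when (suc j * (q / r) ℕ.≟ suc k) (K (suc k))))
          ≡⟨ ∑<-cong r (λ j _ → trans (cong (when (r ∣? q)) (∑<-when (gcd (suc j) r ℕ.≟ 1) N _))
                                      (∑<-when (r ∣? q) N (hit′ j))) ⟩
        ∑[ j < r ] ∑[ k < N ] hit i j k
          ∎
        where
        r : ℕ
        r = 2 + i
        hit′ : ℕ → ℕ → ℚ
        hit′ j k = when (gcd (suc j) r ℕ.≟ 1) (when (suc j * (q / r) ℕ.≟ suc k) (K (suc k)))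

      one-preimage : ∀ {k} → k < N → ∑[ i < N ] ∑[ j < 2 + i ] hit i j k ≡ K (suc k)
      one-preimage {k} k<N = trans (∑<-single² N (λ i → 2 + i) (λ i j → hit i j k) i₀<N j₀<r other-rows other-columns)
                                   (hit-value {i₀} {j₀} {k} (proj₁ valid) (proj₁ (proj₂ valid)) (proj₂ (proj₂ valid)))
        where
        x<q : suc k < q
        x<q = subst (suc k <_) (m+[n∸m]≡n (ℕ.>-nonZero⁻¹ q)) (s≤s k<N)
        open LowestTerms (s≤s z≤n) x<q
        i₀ j₀ : ℕ
        i₀ = r₀ ∸ 2
        j₀ = a₀ ∸ 1
        valid-at : ∀ {r a} .{{_ : NonZero r}} → r ≡ r₀ → a ≡ a₀ → r ∣ q × gcd a r ≡ 1 × a * (q / r) ≡ suc k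
        valid-at refl refl = r₀∣q , a₀⊥r₀ , a₀*[q/r₀]≡x
        valid : 2 + i₀ ∣ q × gcd (suc j₀) (2 + i₀) ≡ 1 × suc j₀ * (q / (2 + i₀)) ≡ suc k
        valid = valid-at {2 + i₀} {suc j₀} (m+[n∸m]≡n 2≤r₀) (m+[n∸m]≡n 1≤a₀)
        i₀<N : i₀ < N
        i₀<N = ≤-trans (≤-reflexive (cong ℕ.pred (m+[n∸m]≡n 2≤r₀))) (∸-monoˡ-≤ 1 r₀≤q)
        j₀<r : j₀ < 2 + i₀
        j₀<r = subst₂ _≤_ (sym (m+[n∸m]≡n 1≤a₀)) (sym (m+[n∸m]≡n 2≤r₀)) a₀≤r₀
        other-rows : ∀ i j → i < N → j < 2 + i → i ≢ i₀ → hit i j k ≡ ℚ.0ℚ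
        other-rows i j _ _ i≢i₀ = hit-vanishes {i} {j} λ r∣q a⊥r a*[q/r]≡x → i≢i₀ (cong (_∸ 2)
          (trans (sym (denominator-of-a*[q/r] {2 + i} {suc j} r∣q a⊥r)) (cong (λ y → (q / gcd y q) {{gcd-nonZero y q}}) a*[q/r]≡x)))
        other-columns : ∀ j → j < 2 + i₀ → j ≢ j₀ → hit i₀ j k ≡ ℚ.0ℚ
        other-columns j _ j≢j₀ = hit-vanishes {i₀} {j} λ r∣q a⊥r a*[q/r]≡x → j≢j₀ (cong (_∸ 1)
          (trans (sym (numerator-of-a*[q/r] {2 + i₀} {suc j} r∣q a⊥r)) (cong (λ y → (y / gcd y q) {{gcd-nonZero y q}}) a*[q/r]≡x)))

    ∑-divisors-units : ∑[ r ∈ bigDivisors q ] ∑[ a ∈ units r ] F r a ≡ ∑[ k < N ] K (suc k)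
    ∑-divisors-units = begin
      ∑[ r ∈ bigDivisors q ] ∑[ a ∈ units r ] F r a
        ≡⟨ ∑∈-bigDivisors q _ ⟩
      ∑[ i < N ] when (2 + i ∣? q) (∑[ a ∈ units (2 + i) ] F (2 + i) a)
        ≡⟨ ∑<-cong N (λ i _ → row i) ⟩
      ∑[ i < N ] ∑[ j < 2 + i ] ∑[ k < N ] hit i j k
        ≡⟨ ∑<-cong N (λ i _ → ∑<-comm (2 + i) N (hit i)) ⟩
      ∑[ i < N ] ∑[ k < N ] ∑[ j < 2 + i ] hit i j k
        ≡⟨ ∑<-comm N N _ ⟩
      ∑[ k < N ] ∑[ i < N ] ∑[ j < 2 + i ] hit i j k
        ≡⟨ ∑<-cong N (λ k k<N → one-preimage k<N) ⟩
      ∑[ k < N ] K (suc k)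
        ∎

  ∑-fractions : (Φ : ℚ × ℚ → ℚ) →
                ∑[ r ∈ bigDivisors q ] ∑[ a ∈ units r ] Φ (weightedFraction a r)
                  ≡ ∑[ k < q ∸ 1 ] Φ (weightedResidue q (suc k))
  ∑-fractions Φ = ∑-divisors-units (λ r a → Φ (μ/φ r , frac (+ a) r)) (λ x → Φ (weight q x , frac (+ x) q))
    λ {r} {a} r∣q a⊥r _ _ _ → cong Φ (cong₂ _,_
    (cong μ/φ (sym (denominator-of-a*[q/r] {r} {a} r∣q a⊥r))) (frac[a,r]≡frac[a*[q/r],q] {r} {a} r∣q a⊥r))

integralityTerm : ℚ × ℚ → ℚ × ℚ → ℚ × ℚ → ℚ
integralityTerm (w₁ , f₁) (w₂ , f₂) (w₃ , f₃) =
  w₁ ℚ.* w₂ ℚ.* w₃ ℚ.* when (ℚ.denominatorℕ (f₁ ℚ.+ f₂ ℚ.+ f₃) ℕ.≟ 1) ℚ.1ℚ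

sumℚ≡∑∈ : ∀ xs → sumℚ xs ≡ ∑[ x ∈ xs ] x
sumℚ≡∑∈ []       = refl
sumℚ≡∑∈ (x ∷ xs) = cong (x ℚ.+_) (sumℚ≡∑∈ xs)

weighted-count : ∀ q₁ q₂ q₃ →
  μ/φ q₁ ℚ.* μ/φ q₂ ℚ.* μ/φ q₃ ℚ.* ι (length (admissible q₁ q₂ q₃))
    ≡ ∑[ a₁ ∈ units q₁ ] ∑[ a₂ ∈ units q₂ ] ∑[ a₃ ∈ units q₃ ]
        integralityTerm (weightedFraction a₁ q₁) (weightedFraction a₂ q₂) (weightedFraction a₃ q₃)
weighted-count q₁ q₂ q₃ = begin
  c ℚ.* ι (length (admissible q₁ q₂ q₃))
    ≡⟨ cong (c ℚ.*_) (ι-length-filter _ (unitTriples q₁ q₂ q₃)) ⟩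
  c ℚ.* ∑[ t ∈ unitTriples q₁ q₂ q₃ ] when (ℚ.denominatorℕ (tripleSum q₁ q₂ q₃ t) ℕ.≟ 1) ℚ.1ℚ
    ≡⟨ cong (c ℚ.*_) (trans (∑∈-concatMap _ (units q₁) _) (∑∈-cong (units q₁) λ a₁ →
         trans (∑∈-concatMap _ (units q₂) _) (∑∈-cong (units q₂) λ a₂ → ∑∈-map _ (units q₃) _))) ⟩
  c ℚ.* ∑[ a₁ ∈ units q₁ ] ∑[ a₂ ∈ units q₂ ] ∑[ a₃ ∈ units q₃ ] integral a₁ a₂ a₃
    ≡⟨ ∑∈-*ˡ c (units q₁) _ ⟨
  ∑[ a₁ ∈ units q₁ ] (c ℚ.* ∑[ a₂ ∈ units q₂ ] ∑[ a₃ ∈ units q₃ ] integral a₁ a₂ a₃)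
    ≡⟨ ∑∈-cong (units q₁) (λ a₁ → trans (sym (∑∈-*ˡ c (units q₂) _))
         (∑∈-cong (units q₂) λ a₂ → sym (∑∈-*ˡ c (units q₃) _))) ⟩
  ∑[ a₁ ∈ units q₁ ] ∑[ a₂ ∈ units q₂ ] ∑[ a₃ ∈ units q₃ ] (c ℚ.* integral a₁ a₂ a₃)
    ∎
  where
  open ≡-Reasoning
  c : ℚ
  c = μ/φ q₁ ℚ.* μ/φ q₂ ℚ.* μ/φ q₃
  integral : ℕ → ℕ → ℕ → ℚ
  integral a₁ a₂ a₃ =
    when (ℚ.denominatorℕ (frac (+ a₁) q₁ ℚ.+ frac (+ a₂) q₂ ℚ.+ frac (+ a₃) q₃) ℕ.≟ 1) ℚ.1ℚ

integralityTerm-residues : ∀ N x y z → let q = suc N in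
  integralityTerm (weightedResidue q x) (weightedResidue q y) (weightedResidue q z)
    ≡ weight q x ℚ.* weight q y ℚ.* weight q z ℚ.* divisibility q (x + y + z)
integralityTerm-residues N x y z = cong (weight q x ℚ.* weight q y ℚ.* weight q z ℚ.*_) (begin
  when (ℚ.denominatorℕ (frac (+ x) q ℚ.+ frac (+ y) q ℚ.+ frac (+ z) q) ℕ.≟ 1) ℚ.1ℚ
    ≡⟨ cong (λ f → when (ℚ.denominatorℕ f ℕ.≟ 1) ℚ.1ℚ)
         (trans (cong (ℚ._+ frac (+ z) q) (frac-+-same x y N)) (frac-+-same (x + y) z N)) ⟩
  when (ℚ.denominatorℕ (frac (+ (x + y + z)) q) ℕ.≟ 1) ℚ.1ℚ
    ≡⟨ when-⇔ _ (q ∣? (x + y + z)) (Equivalence.to (denominator≡1⇔∣ (x + y + z) N))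
                                  (Equivalence.from (denominator≡1⇔∣ (x + y + z) N)) ⟩
  divisibility q (x + y + z)
    ∎)
  where
  open ≡-Reasoning
  q : ℕ
  q = suc N

module _ (N : ℕ) where

  private
    q : ℕ
    q = suc N
    B : List ℕ
    B = bigDivisors q
    count : ℕ → ℕ → ℕ → ℚ
    count q₁ q₂ q₃ = μ/φ q₁ ℚ.* μ/φ q₂ ℚ.* μ/φ q₃ ℚ.* ι (length (admissible q₁ q₂ q₃))
    term : ℕ → ℕ → ℕ → ℕ → ℕ → ℕ → ℚ
    term q₁ a₁ q₂ a₂ q₃ a₃ =
      integralityTerm (weightedFraction a₁ q₁) (weightedFraction a₂ q₂) (weightedFraction a₃ q₃)
    open Reparametrisation q using (∑-fractions)
    open ≡-Reasoning

  ∑-admissible≡∑-fractions :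
    sumℚ (concatMap (λ q₁ → concatMap (λ q₂ → map (count q₁ q₂) B) B) B)
      ≡ ∑[ q₁ ∈ B ] ∑[ a₁ ∈ units q₁ ] ∑[ q₂ ∈ B ] ∑[ a₂ ∈ units q₂ ] ∑[ q₃ ∈ B ] ∑[ a₃ ∈ units q₃ ]
          term q₁ a₁ q₂ a₂ q₃ a₃
  ∑-admissible≡∑-fractions = begin
    sumℚ (concatMap (λ q₁ → concatMap (λ q₂ → map (count q₁ q₂) B) B) B)
      ≡⟨ trans (sumℚ≡∑∈ (concatMap (λ q₁ → concatMap (λ q₂ → map (count q₁ q₂) B) B) B))
           (trans (∑∈-concatMap (λ q₁ → concatMap (λ q₂ → map (count q₁ q₂) B) B) B (λ x → x))
           (∑∈-cong B λ q₁ → trans (∑∈-concatMap (λ q₂ → map (count q₁ q₂) B) B (λ x → x))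
           (∑∈-cong B λ q₂ → ∑∈-map (count q₁ q₂) B (λ x → x)))) ⟩
    ∑[ q₁ ∈ B ] ∑[ q₂ ∈ B ] ∑[ q₃ ∈ B ] count q₁ q₂ q₃
      ≡⟨ ∑∈-cong B (λ q₁ → ∑∈-cong B λ q₂ → ∑∈-cong B λ q₃ → weighted-count q₁ q₂ q₃) ⟩
    ∑[ q₁ ∈ B ] ∑[ q₂ ∈ B ] ∑[ q₃ ∈ B ] ∑[ a₁ ∈ units q₁ ] ∑[ a₂ ∈ units q₂ ] ∑[ a₃ ∈ units q₃ ] term q₁ a₁ q₂ a₂ q₃ a₃
      ≡⟨ ∑∈-cong B (λ q₁ → ∑∈-cong B λ q₂ → ∑∈-comm B (units q₁) _) ⟩
    ∑[ q₁ ∈ B ] ∑[ q₂ ∈ B ] ∑[ a₁ ∈ units q₁ ] ∑[ q₃ ∈ B ] ∑[ a₂ ∈ units q₂ ] ∑[ a₃ ∈ units q₃ ] term q₁ a₁ q₂ a₂ q₃ a₃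
      ≡⟨ ∑∈-cong B (λ q₁ → ∑∈-comm B (units q₁) _) ⟩
    ∑[ q₁ ∈ B ] ∑[ a₁ ∈ units q₁ ] ∑[ q₂ ∈ B ] ∑[ q₃ ∈ B ] ∑[ a₂ ∈ units q₂ ] ∑[ a₃ ∈ units q₃ ] term q₁ a₁ q₂ a₂ q₃ a₃
      ≡⟨ ∑∈-cong B (λ q₁ → ∑∈-cong (units q₁) λ a₁ → ∑∈-cong B λ q₂ → ∑∈-comm B (units q₂) _) ⟩
    ∑[ q₁ ∈ B ] ∑[ a₁ ∈ units q₁ ] ∑[ q₂ ∈ B ] ∑[ a₂ ∈ units q₂ ] ∑[ q₃ ∈ B ] ∑[ a₃ ∈ units q₃ ] term q₁ a₁ q₂ a₂ q₃ a₃
      ∎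

  ∑-fractions≡∑-residues :
    ∑[ q₁ ∈ B ] ∑[ a₁ ∈ units q₁ ] ∑[ q₂ ∈ B ] ∑[ a₂ ∈ units q₂ ] ∑[ q₃ ∈ B ] ∑[ a₃ ∈ units q₃ ] term q₁ a₁ q₂ a₂ q₃ a₃
      ≡ ∑[ i < N ] ∑[ j < N ] ∑[ k < N ]
          integralityTerm (weightedResidue q (suc i)) (weightedResidue q (suc j)) (weightedResidue q (suc k))
  ∑-fractions≡∑-residues = begin
    ∑[ q₁ ∈ B ] ∑[ a₁ ∈ units q₁ ] ∑[ q₂ ∈ B ] ∑[ a₂ ∈ units q₂ ] ∑[ q₃ ∈ B ] ∑[ a₃ ∈ units q₃ ] term q₁ a₁ q₂ a₂ q₃ a₃
      ≡⟨ ∑∈-cong B (λ q₁ → ∑∈-cong (units q₁) λ a₁ → ∑∈-cong B λ q₂ → ∑∈-cong (units q₂) λ a₂ →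
           ∑-fractions (integralityTerm (weightedFraction a₁ q₁) (weightedFraction a₂ q₂))) ⟩
    ∑[ q₁ ∈ B ] ∑[ a₁ ∈ units q₁ ] ∑[ q₂ ∈ B ] ∑[ a₂ ∈ units q₂ ] ∑[ k < N ]
      integralityTerm (weightedFraction a₁ q₁) (weightedFraction a₂ q₂) (weightedResidue q (suc k))
      ≡⟨ ∑∈-cong B (λ q₁ → ∑∈-cong (units q₁) λ a₁ →
           ∑-fractions (λ v → ∑[ k < N ] integralityTerm (weightedFraction a₁ q₁) v (weightedResidue q (suc k)))) ⟩
    ∑[ q₁ ∈ B ] ∑[ a₁ ∈ units q₁ ] ∑[ j < N ] ∑[ k < N ]
      integralityTerm (weightedFraction a₁ q₁) (weightedResidue q (suc j)) (weightedResidue q (suc k))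
      ≡⟨ ∑-fractions (λ u → ∑[ j < N ] ∑[ k < N ]
           integralityTerm u (weightedResidue q (suc j)) (weightedResidue q (suc k))) ⟩
    ∑[ i < N ] ∑[ j < N ] ∑[ k < N ]
      integralityTerm (weightedResidue q (suc i)) (weightedResidue q (suc j)) (weightedResidue q (suc k))
      ∎

  ∑-admissible≡∑-residues :
    sumℚ (concatMap (λ q₁ → concatMap (λ q₂ → map (count q₁ q₂) B) B) B)
      ≡ ∑[ i < N ] ∑[ j < N ] ∑[ k < N ]
          (weight q (suc i) ℚ.* weight q (suc j) ℚ.* weight q (suc k) ℚ.* divisibility q (suc i + suc j + suc k))
  ∑-admissible≡∑-residues = trans ∑-admissible≡∑-fractions (trans ∑-fractions≡∑-residues
    (∑<-cong N (λ i _ → ∑<-cong N λ j _ → ∑<-cong N λ k _ → integralityTerm-residues N (suc i) (suc j) (suc k))))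

-- Inclusion–exclusion and the product over the primes

module _ (N : ℕ) (f : ℕ → ℚ) (f0≡1 : f 0 ≡ ℚ.1ℚ) where

  private
    q : ℕ
    q = suc N
    δ : ℕ → ℚ
    δ = divisibility q
    H : ℕ → ℕ → ℕ → ℚ
    H x y z = f x ℚ.* f y ℚ.* f z ℚ.* δ (x + y + z)
    Q : ℕ → ℕ → ℚ
    Q x y = f x ℚ.* f y ℚ.* δ (x + y)
    P : ℕ → ℕ → ℚ
    P x y = ∑< q (H x y)
    T₃ T₂ : ℚ
    T₃ = zeroSumTriples q f
    T₂ = zeroSumPairs q f
    open ≡-Reasoning
    open ℚSolver

    ∑′ : (ℕ → ℚ) → ℚ
    ∑′ g = ∑[ i < N ] g (suc i)

    ∑′≡∑-g0 : ∀ g → ∑′ g ≡ ∑< q g ℚ.- g 0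
    ∑′≡∑-g0 g = solve 2 (λ a b → b := (a :+ b) :- a) refl (g 0) (∑′ g)

    δ0≡1 : δ 0 ≡ ℚ.1ℚ
    δ0≡1 = when-yes (q ∣? 0) (q ∣0)

    ∑fδ≡1 : ∑[ x < q ] (f x ℚ.* δ x) ≡ ℚ.1ℚ
    ∑fδ≡1 = trans (∑<-single q _ (s≤s z≤n) others) (trans (cong₂ ℚ._*_ f0≡1 δ0≡1) (ℚ.*-identityˡ ℚ.1ℚ))
      where
      others : ∀ x → x < q → x ≢ 0 → f x ℚ.* δ x ≡ ℚ.0ℚ
      others zero    _   0≢0 = contradiction refl 0≢0
      others (suc x) x<q _   = trans (cong (f (suc x) ℚ.*_)
        (when-no (q ∣? suc x) (λ q∣1+x → contradiction (∣⇒≤ q∣1+x) (<⇒≱ x<q)))) (ℚ.*-zeroʳ (f (suc x)))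

    H[x,y,0]≡Q[x,y] : ∀ x y → H x y 0 ≡ Q x y
    H[x,y,0]≡Q[x,y] x y = cong₂ ℚ._*_ (trans (cong (f x ℚ.* f y ℚ.*_) f0≡1) (ℚ.*-identityʳ (f x ℚ.* f y)))
                                     (cong δ (+-identityʳ (x + y)))

    H[x,0,z]≡Q[x,z] : ∀ x z → H x 0 z ≡ Q x z
    H[x,0,z]≡Q[x,z] x z = cong₂ ℚ._*_ (cong (ℚ._* f z) (trans (cong (f x ℚ.*_) f0≡1) (ℚ.*-identityʳ (f x))))
                                     (cong (λ w → δ (w + z)) (+-identityʳ x))

    H[0,y,z]≡Q[y,z] : ∀ y z → H 0 y z ≡ Q y z
    H[0,y,z]≡Q[y,z] y z = cong (λ w → w ℚ.* f z ℚ.* δ (y + z)) (trans (cong (ℚ._* f y) f0≡1) (ℚ.*-identityˡ (f y)))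

    Q[x,0]≡fδ : ∀ x → Q x 0 ≡ f x ℚ.* δ x
    Q[x,0]≡fδ x = cong₂ ℚ._*_ (trans (cong (f x ℚ.*_) f0≡1) (ℚ.*-identityʳ (f x))) (cong δ (+-identityʳ x))

    Q[0,y]≡fδ : ∀ y → Q 0 y ≡ f y ℚ.* δ y
    Q[0,y]≡fδ y = cong (ℚ._* δ y) (trans (cong (ℚ._* f y) f0≡1) (ℚ.*-identityˡ (f y)))

    row : ∀ x → ∑′ (λ y → ∑′ (H x y)) ≡ (∑< q (P x) ℚ.- ∑< q (Q x)) ℚ.- (∑< q (Q x) ℚ.- f x ℚ.* δ x)
    row x = begin
      ∑′ (λ y → ∑′ (H x y))
        ≡⟨ ∑<-cong N (λ i _ → trans (∑′≡∑-g0 (H x (suc i))) (cong (λ w → P x (suc i) ℚ.- w) (H[x,y,0]≡Q[x,y] x (suc i)))) ⟩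
      ∑′ (λ y → P x y ℚ.- Q x y)
        ≡⟨ ∑<-- N (λ i → P x (suc i)) (λ i → Q x (suc i)) ⟩
      ∑′ (P x) ℚ.- ∑′ (Q x)
        ≡⟨ cong₂ ℚ._-_ (∑′≡∑-g0 (P x)) (∑′≡∑-g0 (Q x)) ⟩
      (∑< q (P x) ℚ.- P x 0) ℚ.- (∑< q (Q x) ℚ.- Q x 0)
        ≡⟨ cong₂ (λ a b → (∑< q (P x) ℚ.- a) ℚ.- (∑< q (Q x) ℚ.- b))
                 (∑<-cong q (λ z _ → H[x,0,z]≡Q[x,z] x z)) (Q[x,0]≡fδ x) ⟩
      (∑< q (P x) ℚ.- ∑< q (Q x)) ℚ.- (∑< q (Q x) ℚ.- f x ℚ.* δ x)
        ∎

  ∑-nonzero-triples : ∑[ i < N ] ∑[ j < N ] ∑[ k < N ] H (suc i) (suc j) (suc k)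
                        ≡ T₃ ℚ.- T₂ ℚ.- T₂ ℚ.- T₂ ℚ.+ (ℚ.1ℚ ℚ.+ ℚ.1ℚ)
  ∑-nonzero-triples = begin
    ∑′ (λ x → ∑′ (λ y → ∑′ (H x y)))
      ≡⟨ ∑<-cong N (λ i _ → row (suc i)) ⟩
    ∑′ R
      ≡⟨ ∑′≡∑-g0 R ⟩
    ∑< q R ℚ.- R 0
      ≡⟨ cong₂ ℚ._-_ all-rows row-0 ⟩
    ((T₃ ℚ.- T₂) ℚ.- (T₂ ℚ.- ℚ.1ℚ)) ℚ.- ((T₂ ℚ.- ℚ.1ℚ) ℚ.- (ℚ.1ℚ ℚ.- ℚ.1ℚ ℚ.* ℚ.1ℚ))
      ≡⟨ solve 2 (λ a b → ((a :- b) :- (b :- con ℚ.1ℚ)) :- ((b :- con ℚ.1ℚ) :- (con ℚ.1ℚ :- con ℚ.1ℚ :* con ℚ.1ℚ))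
                    := (a :- b :- b :- b) :+ (con ℚ.1ℚ :+ con ℚ.1ℚ)) refl T₃ T₂ ⟩
    T₃ ℚ.- T₂ ℚ.- T₂ ℚ.- T₂ ℚ.+ (ℚ.1ℚ ℚ.+ ℚ.1ℚ)
      ∎
    where
    R : ℕ → ℚ
    R x = (∑< q (P x) ℚ.- ∑< q (Q x)) ℚ.- (∑< q (Q x) ℚ.- f x ℚ.* δ x)
    all-rows : ∑< q R ≡ (T₃ ℚ.- T₂) ℚ.- (T₂ ℚ.- ℚ.1ℚ)
    all-rows = trans (∑<-- q (λ x → ∑< q (P x) ℚ.- ∑< q (Q x)) (λ x → ∑< q (Q x) ℚ.- f x ℚ.* δ x))
      (cong₂ ℚ._-_ (∑<-- q (λ x → ∑< q (P x)) (λ x → ∑< q (Q x)))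
                   (trans (∑<-- q (λ x → ∑< q (Q x)) (λ x → f x ℚ.* δ x)) (cong (λ w → T₂ ℚ.- w) ∑fδ≡1)))
    row-0 : R 0 ≡ (T₂ ℚ.- ℚ.1ℚ) ℚ.- (ℚ.1ℚ ℚ.- ℚ.1ℚ ℚ.* ℚ.1ℚ)
    row-0 = trans
      (cong₂ (λ a b → (a ℚ.- b) ℚ.- (b ℚ.- f 0 ℚ.* δ 0))
        (∑<-cong q (λ y _ → ∑<-cong q λ z _ → H[0,y,z]≡Q[y,z] y z))
        (trans (∑<-cong q (λ y _ → Q[0,y]≡fδ y)) ∑fδ≡1))
      (cong (λ w → (T₂ ℚ.- ℚ.1ℚ) ℚ.- (ℚ.1ℚ ℚ.- w)) (cong₂ ℚ._*_ f0≡1 δ0≡1))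

weight[0]≡1 : ∀ q .{{_ : NonZero q}} → weight q 0 ≡ ℚ.1ℚ
weight[0]≡1 q = cong μ/φ (trans (/-congʳ {{gcd-nonZero 0 q}} (gcd-identityˡ q)) (n/n≡1 q))

record ZeroSumFormulas (q : ℕ) : Set where
  field
    nonZero : NonZero q
    pairs   : zeroSumPairs q (weight q {{nonZero}}) ≡ totientRatio q
    triples : zeroSumTriples q (weight q {{nonZero}}) ≡ totientRatio q ℚ.* totientRatio q

zeroSumFormulas-1 : ZeroSumFormulas 1
zeroSumFormulas-1 = record { nonZero = _ ; pairs = pairs₁ ; triples = triples₁ }
  where
  open ≡-Reasoning
  pairs₁ : zeroSumPairs 1 (weight 1) ≡ totientRatio 1
  pairs₁ = begin
    weight 1 0 ℚ.* weight 1 0 ℚ.* divisibility 1 0 ℚ.+ ℚ.0ℚ ℚ.+ ℚ.0ℚ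
      ≡⟨ cong (λ w → w ℚ.* w ℚ.* divisibility 1 0 ℚ.+ ℚ.0ℚ ℚ.+ ℚ.0ℚ) (weight[0]≡1 1) ⟩
    ℚ.1ℚ ℚ.* ℚ.1ℚ ℚ.* divisibility 1 0 ℚ.+ ℚ.0ℚ ℚ.+ ℚ.0ℚ
      ≡⟨⟩
    totientRatio 1
      ∎
  triples₁ : zeroSumTriples 1 (weight 1) ≡ totientRatio 1 ℚ.* totientRatio 1
  triples₁ = begin
    weight 1 0 ℚ.* weight 1 0 ℚ.* weight 1 0 ℚ.* divisibility 1 0 ℚ.+ ℚ.0ℚ ℚ.+ ℚ.0ℚ ℚ.+ ℚ.0ℚ
      ≡⟨ cong (λ w → w ℚ.* w ℚ.* w ℚ.* divisibility 1 0 ℚ.+ ℚ.0ℚ ℚ.+ ℚ.0ℚ ℚ.+ ℚ.0ℚ) (weight[0]≡1 1) ⟩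
    ℚ.1ℚ ℚ.* ℚ.1ℚ ℚ.* ℚ.1ℚ ℚ.* divisibility 1 0 ℚ.+ ℚ.0ℚ ℚ.+ ℚ.0ℚ ℚ.+ ℚ.0ℚ
      ≡⟨⟩
    totientRatio 1 ℚ.* totientRatio 1
      ∎

zeroSumFormulas-*-prime : ∀ {p m} → Prime p → ¬ p ∣ m → ZeroSumFormulas m → ZeroSumFormulas (p * m)
zeroSumFormulas-*-prime {p@(suc (suc t))} {m} pp p∤m formulas = record
  { nonZero = pm≢0
  ; pairs   = begin
      zeroSumPairs (p * m) (weight (p * m))                           ≡⟨ zeroSumPairs-* p m p⊥m (localWeight-periodic p)
                                                                           (weight-periodic m) weight≡ ⟩
      zeroSumPairs p (localWeight p) ℚ.* zeroSumPairs m (weight m)   ≡⟨ cong₂ ℚ._*_ zeroSumPairs-prime pairs ⟩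
      frac (+ p) (suc t) ℚ.* totientRatio m                          ≡⟨ totientRatio-*-prime pp p∤m ⟨
      totientRatio (p * m)                                           ∎
  ; triples = begin
      zeroSumTriples (p * m) (weight (p * m))                         ≡⟨ zeroSumTriples-* p m p⊥m (localWeight-periodic p)
                                                                           (weight-periodic m) weight≡ ⟩
      zeroSumTriples p (localWeight p) ℚ.* zeroSumTriples m (weight m) ≡⟨ cong₂ ℚ._*_ zeroSumTriples-prime triples ⟩
      (e ℚ.* e) ℚ.* (totientRatio m ℚ.* totientRatio m)              ≡⟨ solve 2 (λ e r → (e :* e) :* (r :* r) := (e :* r) :* (e :* r))
                                                                           refl e (totientRatio m) ⟩
      (e ℚ.* totientRatio m) ℚ.* (e ℚ.* totientRatio m)              ≡⟨ cong₂ ℚ._*_ (totientRatio-*-prime pp p∤m)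
                                                                                     (totientRatio-*-prime pp p∤m) ⟨
      totientRatio (p * m) ℚ.* totientRatio (p * m)                  ∎
  }
  where
  open ZeroSumFormulas formulas
  open LocalFactors t pp
  open ≡-Reasoning
  open ℚSolver
  instance
    m≢0 : NonZero m
    m≢0 = nonZero
    pm≢0 : NonZero (p * m)
    pm≢0 = m*n≢0 p m
  e : ℚ
  e = frac (+ p) (suc t)
  p⊥m : Coprime p m
  p⊥m = prime-∤⇒coprime pp p∤m
  weight≡ : ∀ x → weight (p * m) x ≡ localWeight p x ℚ.* weight m x
  weight≡ x = weight-*-prime pp p∤m x

primeProduct : ℕ → ℕ → ℕ
primeProduct k x = product (filter prime? (interval k x))

primeProduct-step : ∀ k x → (Prime x × primeProduct (suc k) x ≡ x * primeProduct k (suc x))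
                          ⊎ (¬ Prime x × primeProduct (suc k) x ≡ primeProduct k (suc x))
primeProduct-step k x with prime? x
... | yes px  = inj₁ (px , refl)
... | no ¬px = inj₂ (¬px , refl)

prime∣primeProduct⇒≤ : ∀ k x {p} → Prime p → p ∣ primeProduct k x → x ≤ p
prime∣primeProduct⇒≤ zero    x pp p∣1 = contradiction (∣1⇒≡1 p∣1) (prime≢1 pp)
prime∣primeProduct⇒≤ (suc k) x {p} pp p∣product with primeProduct-step k x
... | inj₂ (_ , eq) = <⇒≤ (prime∣primeProduct⇒≤ k (suc x) pp (subst (p ∣_) eq p∣product))
... | inj₁ (px , eq) with euclidsLemma x (primeProduct k (suc x)) pp (subst (p ∣_) eq p∣product)
...   | inj₂ p∣rest = <⇒≤ (prime∣primeProduct⇒≤ k (suc x) pp p∣rest)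
...   | inj₁ p∣x with prime⇒irreducible px p∣x
...     | inj₁ p≡1 = contradiction p≡1 (prime≢1 pp)
...     | inj₂ p≡x = ≤-reflexive (sym p≡x)

zeroSumFormulas-primeProduct : ∀ k x → ZeroSumFormulas (primeProduct k x)
zeroSumFormulas-primeProduct zero    x = zeroSumFormulas-1
zeroSumFormulas-primeProduct (suc k) x with primeProduct-step k x
... | inj₂ (_ , eq)  = subst ZeroSumFormulas (sym eq) (zeroSumFormulas-primeProduct k (suc x))
... | inj₁ (px , eq) = subst ZeroSumFormulas (sym eq)
  (zeroSumFormulas-*-prime px (λ x∣rest → n≮n x (prime∣primeProduct⇒≤ k (suc x) px x∣rest))
                              (zeroSumFormulas-primeProduct k (suc x)))

zeroSumFormulas-primorial : ∀ N → ZeroSumFormulas (primorial N)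
zeroSumFormulas-primorial N =
  subst ZeroSumFormulas (cong (product ∘ filter prime?) (sym (range≡interval 1 N))) (zeroSumFormulas-primeProduct N 1)

∑-admissible : ∀ q → ZeroSumFormulas q → let r = totientRatio q in
  sumℚ (concatMap (λ q₁ → concatMap (λ q₂ → map (λ q₃ →
    μ/φ q₁ ℚ.* μ/φ q₂ ℚ.* μ/φ q₃ ℚ.* ι (length (admissible q₁ q₂ q₃)))
    (bigDivisors q)) (bigDivisors q)) (bigDivisors q))
    ≡ r ℚ.* r ℚ.- r ℚ.- r ℚ.- r ℚ.+ (ℚ.1ℚ ℚ.+ ℚ.1ℚ)
∑-admissible zero    formulas = ⊥-elim (ℕ.≢-nonZero⁻¹ 0 {{ZeroSumFormulas.nonZero formulas}} refl)
∑-admissible (suc N) formulas = begin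
  _ ≡⟨ ∑-admissible≡∑-residues N ⟩
  _ ≡⟨ ∑-nonzero-triples N (weight (suc N)) (weight[0]≡1 (suc N)) ⟩
  _ ≡⟨ cong₂ (λ T₃ T₂ → T₃ ℚ.- T₂ ℚ.- T₂ ℚ.- T₂ ℚ.+ (ℚ.1ℚ ℚ.+ ℚ.1ℚ)) triples pairs ⟩
  _ ∎
  where
  open ≡-Reasoning
  open ZeroSumFormulas formulas

sumℚ-const-range : ∀ h (x : ℚ) → sumℚ (map (λ _ → x) (range 1 h)) ≡ ι h ℚ.* x
sumℚ-const-range h x = begin
  sumℚ (map (λ _ → x) (range 1 h))   ≡⟨ trans (sumℚ≡∑∈ (map (λ _ → x) (range 1 h))) (∑∈-map (λ _ → x) (range 1 h) (λ y → y)) ⟩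
  ∑[ _ ∈ range 1 h ] x               ≡⟨ cong (λ ds → ∑[ _ ∈ ds ] x) (range≡interval 1 h) ⟩
  ∑[ _ ∈ interval h 1 ] x            ≡⟨ ∑∈-interval h 1 (λ _ → x) ⟩
  ∑[ _ < h ] x                       ≡⟨ ∑<-const h x ⟩
  ι h ℚ.* x                          ∎
  where open ≡-Reasoning

lemma2p4 : (h : ℕ) → 1 ≤ h →
    let q = primorial (h ^ 2) in
    let r = frac (+ q) (φ q) in
    (frac (+ 2) 1) ℚ.* sumℚ (map (λ d →
        sumℚ (concatMap (λ q₁ → concatMap (λ q₂ → map (λ q₃ →
          ((frac (μ q₁) (φ q₁)) ℚ.* (frac (μ q₂) (φ q₂)) ℚ.* (frac (μ q₃) (φ q₃)))
          ℚ.* frac (+ length (admissible q₁ q₂ q₃)) 1)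
          (bigDivisors q)) (bigDivisors q)) (bigDivisors q)))
      (range 1 h))
    ≡ frac (+ (2 ℕ.* h)) 1 ℚ.* (r ℚ.* r) ℚ.- frac (+ (6 ℕ.* h)) 1 ℚ.* r ℚ.+ frac (+ (4 ℕ.* h)) 1
lemma2p4 h _ = begin
  ι 2 ℚ.* sumℚ (map (λ _ → A) (range 1 h))
    ≡⟨ cong (ι 2 ℚ.*_) (sumℚ-const-range h A) ⟩
  ι 2 ℚ.* (ι h ℚ.* A)
    ≡⟨ cong (λ a → ι 2 ℚ.* (ι h ℚ.* a)) (∑-admissible q (zeroSumFormulas-primorial (h ^ 2))) ⟩
  ι 2 ℚ.* (ι h ℚ.* (r ℚ.* r ℚ.- r ℚ.- r ℚ.- r ℚ.+ (ℚ.1ℚ ℚ.+ ℚ.1ℚ)))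
    ≡⟨ solve 2 (λ h r → con (ι 2) :* (h :* (r :* r :- r :- r :- r :+ (con ℚ.1ℚ :+ con ℚ.1ℚ)))
                        := (con (ι 2) :* h) :* (r :* r) :- (con (ι 6) :* h) :* r :+ con (ι 4) :* h) refl (ι h) r ⟩
  (ι 2 ℚ.* ι h) ℚ.* (r ℚ.* r) ℚ.- (ι 6 ℚ.* ι h) ℚ.* r ℚ.+ ι 4 ℚ.* ι h
    ≡⟨ cong₂ (λ a b → a ℚ.* (r ℚ.* r) ℚ.- b ℚ.* r ℚ.+ ι 4 ℚ.* ι h) (ι-* 2 h) (ι-* 6 h) ⟨
  ι (2 * h) ℚ.* (r ℚ.* r) ℚ.- ι (6 * h) ℚ.* r ℚ.+ ι 4 ℚ.* ι h
    ≡⟨ cong (ι (2 * h) ℚ.* (r ℚ.* r) ℚ.- ι (6 * h) ℚ.* r ℚ.+_) (ι-* 4 h) ⟨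
  ι (2 * h) ℚ.* (r ℚ.* r) ℚ.- ι (6 * h) ℚ.* r ℚ.+ ι (4 * h)
    ∎
  where
  open ≡-Reasoning
  open ℚSolver
  q : ℕ
  q = primorial (h ^ 2)
  r : ℚ
  r = totientRatio q
  A : ℚ
  A = sumℚ (concatMap (λ q₁ → concatMap (λ q₂ → map (λ q₃ →
        μ/φ q₁ ℚ.* μ/φ q₂ ℚ.* μ/φ q₃ ℚ.* ι (length (admissible q₁ q₂ q₃)))
        (bigDivisors q)) (bigDivisors q)) (bigDivisors q))
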